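{- Let $G$ be a finite cubic graph and let $v,w$ be distinct vertices of $G$. Then in the Hamilton incidence multigraph $H(G,v,w)$, for any two distinct vertices $p,q$ lying in the same side of the bipartition (i.e. both in $[E(v)]^2$ or both in $[E(w)]^2$), the sum of degrees $d_H(p)+d_H(q)$ is even.
   Context: Graphs are simple; a cubic graph has all vertex degrees equal to $3$. For a vertex $u$, $E(u)$ is the set of edges incident with $u$, and $[E(u)]^2$ is the set of $2$-element subsets of $E(u)$. For distinct vertices $v,w$ of $G$, the Hamilton incidence multigraph $H=H(G,v,w)$ is the bipartite multigraph with vertex set the disjoint union $[E(v)]^2 \sqcup [E(w)]^2$, in which for $p\in[E(v)]^2$ and $q\in[E(w)]^2$ the number of edges between $p$ and $q$ equals the number of Hamilton cycles $D$ of $G$ with $p\cup q\subseteq E(D)$ (and there are no other edges). Degrees in $H$ count edges with multiplicity. -}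

module Defs where

open import Data.Bool using (Bool; true; false; _∧_; _∨_; if_then_else_)
open import Data.Nat using (ℕ; zero; suc; _+_)
import Data.Nat
import Data.Fin
open import Data.Fin using (Fin; _<_)
open import Data.Fin.Properties using (_≟_)
open import Data.List using (List; []; _∷_; concatMap; map; allFin)
open import Data.Vec using (Vec; []; _∷_; lookup)
open import Data.Product using (Σ; _×_; _,_)
open import Relation.Binary.PropositionalEquality using (_≡_)
open import Relation.Nullary.Decidable using (⌊_⌋)

record Graph : Set where
  field
    n      : ℕ
    adj    : Fin n → Fin n → Bool
    sym    : ∀ x y → adj x y ≡ adj y x
    irrefl : ∀ x → adj x x ≡ false

open Graph public

count : {A : Set} → (A → Bool) → List A → ℕ
count P []       = 0
count P (x ∷ xs) = if P x then suc (count P xs) else count P xs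

sumL : {A : Set} → (A → ℕ) → List A → ℕ
sumL f []       = 0
sumL f (x ∷ xs) = f x + sumL f xs

allB : {A : Set} → (A → Bool) → List A → Bool
allB P []       = true
allB P (x ∷ xs) = P x ∧ allB P xs

anyB : {A : Set} → (A → Bool) → List A → Bool
anyB P []       = false
anyB P (x ∷ xs) = P x ∨ anyB P xs

deg : (G : Graph) → Fin (n G) → ℕ
deg G x = count (adj G x) (allFin (n G))

Cubic : Graph → Set
Cubic G = ∀ x → deg G x ≡ 3

-- Edge sets of G's vertex set: a set D of unordered pairs is encoded by
-- its (symmetric) 0/1 incidence matrix; {x,y} ∈ D  iff  lookup (lookup D x) y.

EdgeSet : ℕ → Set
EdgeSet n = Vec (Vec Bool n) n

_∋ₑ_,_ : ∀ {n} → EdgeSet n → Fin n → Fin n → Bool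
D ∋ₑ x , y = lookup (lookup D x) y

allVec : {A : Set} → List A → (k : ℕ) → List (Vec A k)
allVec xs zero    = [] ∷ []
allVec xs (suc k) = concatMap (λ x → map (x ∷_) (allVec xs k)) xs

allEdgeSets : (n : ℕ) → List (EdgeSet n)
allEdgeSets n = allVec (allVec (true ∷ false ∷ []) n) n

module _ (G : Graph) where
  private
    V = allFin (n G)

  reach : EdgeSet (n G) → ℕ → Fin (n G) → Fin (n G) → Bool
  reach D zero    x y = ⌊ x ≟ y ⌋
  reach D (suc k) x y = reach D k x y ∨ anyB (λ z → reach D k x z ∧ (D ∋ₑ z , y)) V

  -- D is (the edge set of) a Hamilton cycle of G: D is a symmetric set of
  -- edges of G, the spanning subgraph (V(G), D) is 2-regular and connected.
  -- (For a simple graph this is exactly E(C) for a cycle C through all vertices.)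
  isHamCycle : EdgeSet (n G) → Bool
  isHamCycle D =
    allB (λ x → allB (λ y →
      (if D ∋ₑ x , y then (D ∋ₑ y , x) ∧ adj G x y else true)) V) V
    ∧ allB (λ x → ⌊ count (λ y → D ∋ₑ x , y) V Data.Nat.≟ 2 ⌋) V
    ∧ allB (λ x → allB (λ y → reach D (n G) x y) V) V

  -- A vertex of [E(u)]^2: a 2-subset {ua, ub} of edges at u, encoded by the
  -- two distinct neighbours a < b of u.
  Pair2 : Fin (n G) → Set
  Pair2 u = Σ (Fin (n G)) λ a → Σ (Fin (n G)) λ b →
              (adj G u a ≡ true) × (adj G u b ≡ true) × (a < b)

  pairs2 : Fin (n G) → List (Fin (n G) × Fin (n G))
  pairs2 u = concatMap (λ a → concatMap (λ b →
      if adj G u a ∧ adj G u b ∧ ⌊ a Data.Fin.<? b ⌋ then (a , b) ∷ [] else []) V) V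

  -- number of Hamilton cycles D with {va,vb,wc,wd} ⊆ E(D)
  -- (= multiplicity of the H-edge between {va,vb} and {wc,wd})
  mult : (v w a b c d : Fin (n G)) → ℕ
  mult v w a b c d = count (λ D → isHamCycle D ∧ (D ∋ₑ v , a) ∧ (D ∋ₑ v , b)
                                   ∧ (D ∋ₑ w , c) ∧ (D ∋ₑ w , d))
                           (allEdgeSets (n G))

  degHˡ : (v w : Fin (n G)) → Pair2 v → ℕ
  degHˡ v w (a , b , _) = sumL (λ { (c , d) → mult v w a b c d }) (pairs2 w)

  degHʳ : (v w : Fin (n G)) → Pair2 w → ℕ
  degHʳ v w (c , d , _) = sumL (λ { (a , b) → mult v w a b c d }) (pairs2 v)

-- Every Hamilton cycle D uses exactly one pair of edges at w, so summing the multiplicities at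
-- p ∈ [E(v)]² counts each Hamilton cycle through both edges of p once: d_H(p) is the number h(p) of
-- such cycles.  If the edges at v are e₁, e₂, e₃, a Hamilton cycle uses exactly two of them, so
-- h({eᵢ , eⱼ}) + t(e_k) = T, where t(e) counts the Hamilton cycles through e and T all Hamilton
-- cycles.  By Smith's theorem every t(e) is even, hence all h(p) have the parity of T and any two
-- degrees on one side of H add up to an even number.
--
-- Smith's theorem is proved by Thomason's lollipop argument.  Hamilton cycles through uv correspond
-- to Hamilton paths u, v, … whose endpoint x is adjacent to u.  For any Hamilton path from u, v the
-- three neighbours of x are its predecessor, possibly u, and the remaining ones P k; each such chord
-- x P k yields the Pósa rotation P 0 … P k, x, … P (k+1), and rotating is a fixed-point-free involution
-- on (path , chord) pairs.  Counting neighbours of x over all paths then shows that the paths which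
-- close up are even in number.

module Submission where

open import Defs hiding (sym)
open import Data.Bool using (Bool; true; false; _∧_; _∨_; not; if_then_else_; T)
open import Data.Bool.Properties using (∧-conicalˡ; ∧-conicalʳ; ∨-identityʳ; ∨-zeroʳ; T-≡)
import Data.Bool.Properties as Bool
open import Data.Empty using (⊥; ⊥-elim)
open import Data.Fin using (Fin; zero; suc; toℕ; fromℕ<; punchOut)
import Data.Fin.Properties as Fin
open import Data.List using (List; []; _∷_; concatMap; map; allFin; tabulate; _++_; length)
open import Data.List.Properties using (map-tabulate; length-tabulate)
open import Data.Nat using (ℕ; zero; suc; _+_; _*_; _∸_; _≤_; _<_; z≤n; s≤s; _<ᵇ_; _≤ᵇ_; _<?_; _≤?_)
open import Data.Nat.Properties
open import Algebra.Properties.CommutativeSemigroup +-commutativeSemigroup using (interchange)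
open import Data.Nat.Divisibility using (_∣_; divides; ∣m+n∣m⇒∣n; ∣m∣n⇒∣m+n)
open import Data.Product using (Σ; _×_; _,_; proj₁; proj₂)
open import Data.Sum using (_⊎_; inj₁; inj₂)
open import Data.Unit using (tt)
open import Data.Vec using (Vec; []; _∷_; lookup)
import Data.Vec as Vec
import Data.Vec.Properties as Vec
open import Function using (_∘_; id; Equivalence)
open import Relation.Binary.Definitions using (DecidableEquality; Tri; tri<; tri≈; tri>)
open import Relation.Binary.PropositionalEquality
open import Relation.Nullary using (Dec; yes; no; ¬_; contradiction)
open import Relation.Nullary.Decidable using (⌊_⌋; toWitness; fromWitness)

-- Indicators, finite sums and counting

false≢true : false ≢ true
false≢true ()

ind : Bool → ℕ
ind true  = 1
ind false = 0

T⇒≡true : ∀ {b} → T b → b ≡ true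
T⇒≡true = Equivalence.to T-≡

≡true⇒T : ∀ {b} → b ≡ true → T b
≡true⇒T = Equivalence.from T-≡

∨-true : ∀ {x y} → x ∨ y ≡ true → x ≡ true ⊎ y ≡ true
∨-true {true}  _  = inj₁ refl
∨-true {false} xy = inj₂ xy

not-true : ∀ {x} → not x ≡ true → x ≡ false
not-true {false} _ = refl

not-false : ∀ {x} → x ≡ false → not x ≡ true
not-false refl = refl

¬T⇒≡false : ∀ {b} → ¬ T b → b ≡ false
¬T⇒≡false {true}  ¬Tb = ⊥-elim (¬Tb tt)
¬T⇒≡false {false} _   = refl

<ᵇ-true : ∀ {m n} → m < n → (m <ᵇ n) ≡ true
<ᵇ-true = T⇒≡true ∘ <⇒<ᵇ

<ᵇ-false : ∀ {m n} → ¬ m < n → (m <ᵇ n) ≡ false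
<ᵇ-false {m} {n} m≮n = ¬T⇒≡false (m≮n ∘ <ᵇ⇒< m n)

≤ᵇ-true : ∀ {m n} → m ≤ n → (m ≤ᵇ n) ≡ true
≤ᵇ-true = T⇒≡true ∘ ≤⇒≤ᵇ

≤ᵇ-false : ∀ {m n} → ¬ m ≤ n → (m ≤ᵇ n) ≡ false
≤ᵇ-false {m} {n} m≰n = ¬T⇒≡false (m≰n ∘ ≤ᵇ⇒≤ m n)

ind-∧-factorˡ : ∀ h x y z → ind (h ∧ (x ∧ (y ∧ z))) ≡ ind (h ∧ (x ∧ y)) * ind z
ind-∧-factorˡ false _     _     _ = refl
ind-∧-factorˡ true  false _     _ = refl
ind-∧-factorˡ true  true  false _ = refl
ind-∧-factorˡ true  true  true  z = sym (+-identityʳ (ind z))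

ind-∧-factorʳ : ∀ h x y z → ind (h ∧ (x ∧ (y ∧ z))) ≡ ind (h ∧ z) * ind (x ∧ y)
ind-∧-factorʳ false _     _     _     = refl
ind-∧-factorʳ true  true  true  true  = refl
ind-∧-factorʳ true  true  true  false = refl
ind-∧-factorʳ true  true  false true  = refl
ind-∧-factorʳ true  true  false false = refl
ind-∧-factorʳ true  false _     true  = refl
ind-∧-factorʳ true  false _     false = refl

ind-two-of-three : ∀ x y z → ind x + ind y + ind z ≡ 2 → ind (x ∧ y) + ind z ≡ 1
ind-two-of-three true  true  true  ()
ind-two-of-three true  true  false _ = refl
ind-two-of-three true  false true  _ = refl
ind-two-of-three true  false false ()
ind-two-of-three false true  true  _ = refl
ind-two-of-three false true  false ()
ind-two-of-three false false true  ()
ind-two-of-three false false false ()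

ind-∧-sum : (h p q : Bool) → (h ≡ true → ind p + ind q ≡ 1) → ind (h ∧ p) + ind (h ∧ q) ≡ ind h
ind-∧-sum true  p q one = one refl
ind-∧-sum false p q one = refl

ind-split-positions : ∀ f p a → (f ≡ true → p ≡ false) →
  ind a ≡ ind ((not f ∧ not p) ∧ a) + ind (f ∧ a) + ind (p ∧ a)
ind-split-positions true  true  _     f⇒¬p = ⊥-elim (false≢true (sym (f⇒¬p refl)))
ind-split-positions true  false true  _ = refl
ind-split-positions true  false false _ = refl
ind-split-positions false true  true  _ = refl
ind-split-positions false true  false _ = refl
ind-split-positions false false true  _ = refl
ind-split-positions false false false _ = refl

count≡sumL-ind : {A : Set} (P : A → Bool) (L : List A) → count P L ≡ sumL (ind ∘ P) L
count≡sumL-ind P []      = refl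
count≡sumL-ind P (x ∷ L) with P x
... | true  = cong suc (count≡sumL-ind P L)
... | false = count≡sumL-ind P L

sumL-cong : {A : Set} {f g : A → ℕ} (L : List A) → (∀ x → f x ≡ g x) → sumL f L ≡ sumL g L
sumL-cong []      f≗g = refl
sumL-cong (x ∷ L) f≗g = cong₂ _+_ (f≗g x) (sumL-cong L f≗g)

sumL-+ : {A : Set} (f g : A → ℕ) (L : List A) → sumL (λ x → f x + g x) L ≡ sumL f L + sumL g L
sumL-+ f g []      = refl
sumL-+ f g (x ∷ L) = trans (cong (f x + g x +_) (sumL-+ f g L)) (interchange (f x) (g x) (sumL f L) (sumL g L))

sumL-*ˡ : {A : Set} (c : ℕ) (f : A → ℕ) (L : List A) → sumL (λ x → c * f x) L ≡ c * sumL f L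
sumL-*ˡ c f []      = sym (*-zeroʳ c)
sumL-*ˡ c f (x ∷ L) = trans (cong (c * f x +_) (sumL-*ˡ c f L)) (sym (*-distribˡ-+ c (f x) (sumL f L)))

sumL-*ʳ : {A : Set} (c : ℕ) (f : A → ℕ) (L : List A) → sumL (λ x → f x * c) L ≡ sumL f L * c
sumL-*ʳ c f L = trans (sumL-cong L (λ x → *-comm (f x) c)) (trans (sumL-*ˡ c f L) (*-comm c _))

sumL-zero : {A : Set} (L : List A) → sumL (λ _ → 0) L ≡ 0
sumL-zero []      = refl
sumL-zero (x ∷ L) = sumL-zero L

sumL-++ : {A : Set} (f : A → ℕ) (L M : List A) → sumL f (L ++ M) ≡ sumL f L + sumL f M
sumL-++ f []      M = refl
sumL-++ f (x ∷ L) M = trans (cong (f x +_) (sumL-++ f L M)) (sym (+-assoc (f x) _ _))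

sumL-concatMap : {A B : Set} (f : B → ℕ) (h : A → List B) (L : List A) →
  sumL f (concatMap h L) ≡ sumL (λ x → sumL f (h x)) L
sumL-concatMap f h []      = refl
sumL-concatMap f h (x ∷ L) =
  trans (sumL-++ f (h x) (concatMap h L)) (cong (sumL f (h x) +_) (sumL-concatMap f h L))

sumL-map : {A B : Set} (f : B → ℕ) (h : A → B) (L : List A) → sumL f (map h L) ≡ sumL (f ∘ h) L
sumL-map f h []      = refl
sumL-map f h (x ∷ L) = cong (f (h x) +_) (sumL-map f h L)

sumL-if : {A : Set} (f : A → ℕ) (c : Bool) (x : A) → sumL f (if c then x ∷ [] else []) ≡ ind c * f x
sumL-if f true  x = refl
sumL-if f false x = refl

sumL-swap : {A B : Set} (h : A → B → ℕ) (L : List A) (M : List B) →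
  sumL (λ a → sumL (h a) M) L ≡ sumL (λ b → sumL (λ a → h a b) L) M
sumL-swap h []      M = sym (sumL-zero M)
sumL-swap h (x ∷ L) M =
  trans (cong (sumL (h x) M +_) (sumL-swap h L M)) (sym (sumL-+ (h x) (λ b → sumL (λ a → h a b) L) M))

sumL-mono : {A : Set} {f g : A → ℕ} (L : List A) → (∀ x → f x ≤ g x) → sumL f L ≤ sumL g L
sumL-mono []      f≤g = z≤n
sumL-mono (x ∷ L) f≤g = +-mono-≤ (f≤g x) (sumL-mono L f≤g)

count-witness : {A : Set} (P : A → Bool) (L : List A) {k : ℕ} → count P L ≡ suc k → Σ A λ c → P c ≡ true
count-witness P (x ∷ L) eq with P x in Px
... | true  = x , Px
... | false = count-witness P L eq

module Enumeration {A : Set} (_≟_ : DecidableEquality A) where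

  _==_ : A → A → Bool
  x == y = ⌊ x ≟ y ⌋

  ==-refl : ∀ x → (x == x) ≡ true
  ==-refl x with x ≟ x
  ... | yes _   = refl
  ... | no x≢x = ⊥-elim (x≢x refl)

  ==-≢ : ∀ {x y} → x ≢ y → (x == y) ≡ false
  ==-≢ {x} {y} x≢y with x ≟ y
  ... | yes x≡y = ⊥-elim (x≢y x≡y)
  ... | no _    = refl

  ==-sound : ∀ {x y} → (x == y) ≡ true → x ≡ y
  ==-sound {x} {y} eq with x ≟ y
  ... | yes x≡y = x≡y

  _∖_ : (A → Bool) → A → A → Bool
  (P ∖ c) x = P x ∧ not (x == c)

  record Enumerates (L : List A) : Set where
    field
      exactly-once : ∀ c → sumL (λ x → ind (x == c)) L ≡ 1
  open Enumerates public

  module _ {L : List A} (enum : Enumerates L) where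

    sumL-*-ind : (m : ℕ) (c : A) → sumL (λ x → m * ind (x == c)) L ≡ m
    sumL-*-ind m c = trans (sumL-*ˡ m _ L) (trans (cong (m *_) (exactly-once enum c)) (*-identityʳ m))

    sumL-single : (f : A → ℕ) (c : A) → (∀ x → x ≢ c → f x ≡ 0) → sumL f L ≡ f c
    sumL-single f c vanish = begin
        sumL f L                            ≡⟨ sumL-cong L at-c ⟩
        sumL (λ x → ind (x == c) * f c) L   ≡⟨ sumL-*ʳ (f c) _ L ⟩
        sumL (λ x → ind (x == c)) L * f c   ≡⟨ cong (_* f c) (exactly-once enum c) ⟩
        1 * f c                             ≡⟨ *-identityˡ (f c) ⟩
        f c                                 ∎
      where
      open ≡-Reasoning
      at-c : ∀ x → f x ≡ ind (x == c) * f c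
      at-c x with x ≟ c
      ... | yes refl = sym (+-identityʳ (f x))
      ... | no x≢c   = vanish x x≢c

    restrict : (f : A → ℕ) (c : A) → A → ℕ
    restrict f c x = if x == c then f x else 0

    sumL-restrict : (f : A → ℕ) (c : A) → sumL (restrict f c) L ≡ f c
    sumL-restrict f c = trans (sumL-single (restrict f c) c vanish) (cong (λ b → if b then f c else 0) (==-refl c))
      where
      vanish : ∀ x → x ≢ c → restrict f c x ≡ 0
      vanish x x≢c = cong (λ b → if b then f x else 0) (==-≢ x≢c)

    sumL-remove : (f : A → ℕ) (c : A) → sumL f L ≡ f c + sumL (λ x → if x == c then 0 else f x) L
    sumL-remove f c = trans (sumL-cong L split) (trans (sumL-+ _ _ L) (cong (_+ sumL (λ x → if x == c then 0 else f x) L) (sumL-restrict f c)))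
      where
      split : ∀ x → f x ≡ restrict f c x + (if x == c then 0 else f x)
      split x with x == c
      ... | true  = sym (+-identityʳ (f x))
      ... | false = refl

    sumL-pair : (f : A → ℕ) (c d : A) → c ≢ d → (∀ x → x ≢ c → x ≢ d → f x ≡ 0) →
      sumL f L ≡ f c + f d
    sumL-pair f c d c≢d vanish = trans (sumL-remove f c) (cong (f c +_) (trans (sumL-single _ d vanish′) at-d))
      where
      at-d : (if d == c then 0 else f d) ≡ f d
      at-d = cong (λ b → if b then 0 else f d) (==-≢ (c≢d ∘ sym))
      vanish′ : ∀ x → x ≢ d → (if x == c then 0 else f x) ≡ 0
      vanish′ x x≢d with x ≟ c
      ... | yes _   = refl
      ... | no x≢c = vanish x x≢c x≢d

    sumL-triple : (f : A → ℕ) (c d e : A) → c ≢ d → c ≢ e → d ≢ e →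
      (∀ x → x ≢ c → x ≢ d → x ≢ e → f x ≡ 0) → sumL f L ≡ f c + f d + f e
    sumL-triple f c d e c≢d c≢e d≢e vanish = begin
        sumL f L                                   ≡⟨ sumL-remove f c ⟩
        f c + sumL f′ L                            ≡⟨ cong (f c +_) (sumL-pair f′ d e d≢e vanish′) ⟩
        f c + (f′ d + f′ e)                        ≡⟨ cong (f c +_) (cong₂ _+_ (away d (c≢d ∘ sym)) (away e (c≢e ∘ sym))) ⟩
        f c + (f d + f e)                          ≡⟨ sym (+-assoc (f c) _ _) ⟩
        f c + f d + f e                            ∎
      where
      open ≡-Reasoning
      f′ : A → ℕ
      f′ x = if x == c then 0 else f x
      away : ∀ x → x ≢ c → f′ x ≡ f x
      away x x≢c = cong (λ b → if b then 0 else f x) (==-≢ x≢c)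
      vanish′ : ∀ x → x ≢ d → x ≢ e → f′ x ≡ 0
      vanish′ x x≢d x≢e with x ≟ c
      ... | yes _   = refl
      ... | no x≢c = vanish x x≢c x≢d x≢e

    ≤-sumL : (f : A → ℕ) (c : A) → f c ≤ sumL f L
    ≤-sumL f c = subst (_≤ sumL f L) (sumL-restrict f c) (sumL-mono L restrict≤)
      where
      restrict≤ : ∀ x → restrict f c x ≤ f x
      restrict≤ x with x == c
      ... | true  = ≤-refl
      ... | false = z≤n

    count≡0⇒false : (P : A → Bool) → count P L ≡ 0 → ∀ x → P x ≡ false
    count≡0⇒false P none x with P x in Px
    ... | false = refl
    ... | true  = contradiction (subst (λ b → ind b ≤ 0) Px bound) λ ()
      where
      bound : ind (P x) ≤ 0
      bound = ≤-trans (≤-sumL (ind ∘ P) x) (≤-reflexive (trans (sym (count≡sumL-ind P L)) none))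

    count-remove : (P : A → Bool) (c : A) → P c ≡ true →
      count P L ≡ suc (count (P ∖ c) L)
    count-remove P c Pc = begin
        count P L                                  ≡⟨ count≡sumL-ind P L ⟩
        sumL (ind ∘ P) L                           ≡⟨ sumL-remove (ind ∘ P) c ⟩
        ind (P c) + sumL (λ x → if x == c then 0 else ind (P x)) L
          ≡⟨ cong₂ _+_ (cong ind Pc) (sumL-cong L off-c) ⟩
        1 + sumL (ind ∘ (P ∖ c)) L                 ≡⟨ cong suc (sym (count≡sumL-ind (P ∖ c) L)) ⟩
        suc (count (P ∖ c) L)                      ∎
      where
      open ≡-Reasoning
      off-c : ∀ x → (if x == c then 0 else ind (P x)) ≡ ind ((P ∖ c) x)
      off-c x with x == c | P x
      ... | true  | true  = refl
      ... | true  | false = refl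
      ... | false | true  = refl
      ... | false | false = refl

    ⊆∧count≡⇒≡ : (P Q : A → Bool) → (∀ x → P x ≡ true → Q x ≡ true) → count P L ≡ count Q L → ∀ x → P x ≡ Q x
    ⊆∧count≡⇒≡ P Q P⊆Q same-count x = by-cases (P x) (Q x) refl refl
      where
      split : ∀ y → ind (Q y) ≡ ind (P y) + ind (Q y ∧ not (P y))
      split y with P y in Py | Q y in Qy
      ... | true  | true  = refl
      ... | true  | false = ⊥-elim (false≢true (trans (sym Qy) (P⊆Q y Py)))
      ... | false | true  = refl
      ... | false | false = refl
      no-extra : count (λ y → Q y ∧ not (P y)) L ≡ 0
      no-extra = +-cancelˡ-≡ (count P L) _ 0 (begin
          count P L + count (λ y → Q y ∧ not (P y)) L
            ≡⟨ cong₂ _+_ (count≡sumL-ind P L) (count≡sumL-ind _ L) ⟩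
          sumL (ind ∘ P) L + sumL (λ y → ind (Q y ∧ not (P y))) L
            ≡⟨ sym (sumL-+ _ _ L) ⟩
          sumL (λ y → ind (P y) + ind (Q y ∧ not (P y))) L
            ≡⟨ sym (sumL-cong L split) ⟩
          sumL (ind ∘ Q) L
            ≡⟨ sym (count≡sumL-ind Q L) ⟩
          count Q L
            ≡⟨ sym same-count ⟩
          count P L
            ≡⟨ sym (+-identityʳ _) ⟩
          count P L + 0 ∎)
        where open ≡-Reasoning
      by-cases : ∀ p q → P x ≡ p → Q x ≡ q → p ≡ q
      by-cases true  q     Px Qx = trans (sym (P⊆Q x Px)) Qx
      by-cases false false _  _  = refl
      by-cases false true  Px Qx =
        ⊥-elim (false≢true (trans (sym (count≡0⇒false (λ y → Q y ∧ not (P y)) no-extra x)) (cong₂ _∧_ Qx (cong not Px))))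

    private
      removed : (P : A → Bool) (c : A) → ∀ {x} → (P ∖ c) x ≡ true → P x ≡ true × x ≢ c
      removed P c {x} P∖c = ∧-conicalˡ (P x) _ P∖c , λ { refl → x≢x (∧-conicalʳ (P x) _ P∖c) }
        where
        x≢x : not (x == x) ≡ true → ⊥
        x≢x eq = false≢true (trans (sym (cong not (==-refl x))) eq)

      kept : (P : A → Bool) (c : A) → ∀ {x} → P x ≡ true → x ≢ c → (P ∖ c) x ≡ true
      kept P c Px x≢c rewrite Px | ==-≢ x≢c = refl

      count-∖ : (P : A → Bool) (c : A) → P c ≡ true → ∀ {k} → count P L ≡ suc k → count (P ∖ c) L ≡ k
      count-∖ P c Pc Psk = suc-injective (trans (sym (count-remove P c Pc)) Psk)

    count≡1⇒unique : (P : A → Bool) → count P L ≡ 1 →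
      Σ A λ c → P c ≡ true × (∀ x → P x ≡ true → x ≡ c)
    count≡1⇒unique P one with count-witness P L one
    ... | c , Pc = c , Pc , only-c
      where
      only-c : ∀ x → P x ≡ true → x ≡ c
      only-c x Px with x ≟ c
      ... | yes x≡c = x≡c
      ... | no x≢c  = ⊥-elim (false≢true (trans (sym (count≡0⇒false (P ∖ c) (count-∖ P c Pc one) x)) (kept P c Px x≢c)))

    count≡2⇒two : (P : A → Bool) → count P L ≡ 2 →
      Σ A λ c → Σ A λ d → c ≢ d × P c ≡ true × P d ≡ true × (∀ x → P x ≡ true → x ≡ c ⊎ x ≡ d)
    count≡2⇒two P two with count-witness P L two
    ... | c , Pc with count≡1⇒unique (P ∖ c) (count-∖ P c Pc two)
    ...   | d , P∖c[d] , only-d = c , d , (λ c≡d → proj₂ (removed P c P∖c[d]) (sym c≡d)) , Pc , proj₁ (removed P c P∖c[d]) , only-c-d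
      where
      only-c-d : ∀ x → P x ≡ true → x ≡ c ⊎ x ≡ d
      only-c-d x Px with x ≟ c
      ... | yes x≡c = inj₁ x≡c
      ... | no x≢c  = inj₂ (only-d x (kept P c Px x≢c))

    count≡2⇒no-three : (P : A → Bool) → count P L ≡ 2 → ∀ a b c → a ≢ b → a ≢ c → b ≢ c →
      P a ≡ true → P b ≡ true → P c ≡ true → ⊥
    count≡2⇒no-three P two a b c a≢b a≢c b≢c Pa Pb Pc with count≡2⇒two P two
    ... | x , y , _ , _ , _ , only with only a Pa | only b Pb | only c Pc
    ... | inj₁ refl | inj₁ refl | _         = a≢b refl
    ... | inj₁ refl | inj₂ refl | inj₁ refl = a≢c refl
    ... | inj₁ refl | inj₂ refl | inj₂ refl = b≢c refl
    ... | inj₂ refl | inj₁ refl | inj₁ refl = b≢c refl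
    ... | inj₂ refl | inj₁ refl | inj₂ refl = a≢c refl
    ... | inj₂ refl | inj₂ refl | _         = a≢b refl

    count≡3⇒third : (P : A → Bool) → count P L ≡ 3 → ∀ {a b} → a ≢ b → P a ≡ true → P b ≡ true →
      Σ A λ k → P k ≡ true × a ≢ k × b ≢ k × (∀ x → P x ≡ true → x ≡ a ⊎ x ≡ b ⊎ x ≡ k)
    count≡3⇒third P three {a} {b} a≢b Pa Pb
      with count≡1⇒unique ((P ∖ a) ∖ b) (count-∖ (P ∖ a) b (kept P a Pb (a≢b ∘ sym)) (count-∖ P a Pa three))
    ... | k , P∖a∖b[k] , only-k = k , Pk , (λ a≡k → k≢a (sym a≡k)) , (λ b≡k → k≢b (sym b≡k)) , only
      where
      P∖a[k] : (P ∖ a) k ≡ true × k ≢ b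
      P∖a[k] = removed (P ∖ a) b P∖a∖b[k]
      Pk : P k ≡ true
      Pk = proj₁ (removed P a (proj₁ P∖a[k]))
      k≢a : k ≢ a
      k≢a = proj₂ (removed P a (proj₁ P∖a[k]))
      k≢b : k ≢ b
      k≢b = proj₂ P∖a[k]
      only : ∀ x → P x ≡ true → x ≡ a ⊎ x ≡ b ⊎ x ≡ k
      only x Px with x ≟ a | x ≟ b
      ... | yes x≡a | _       = inj₁ x≡a
      ... | no _    | yes x≡b = inj₂ (inj₁ x≡b)
      ... | no x≢a  | no x≢b  = inj₂ (inj₂ (only-k x (kept (P ∖ a) b (kept P a Px x≢a) x≢b)))

allB-tabulate⁻ : {A : Set} (P : A → Bool) {n : ℕ} (f : Fin n → A) → allB P (tabulate f) ≡ true → ∀ i → P (f i) ≡ true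
allB-tabulate⁻ P f all zero    = ∧-conicalˡ (P (f zero)) _ all
allB-tabulate⁻ P f all (suc i) = allB-tabulate⁻ P (f ∘ suc) (∧-conicalʳ (P (f zero)) _ all) i

allB-tabulate⁺ : {A : Set} (P : A → Bool) {n : ℕ} (f : Fin n → A) → (∀ i → P (f i) ≡ true) → allB P (tabulate f) ≡ true
allB-tabulate⁺ P {zero}  f all = refl
allB-tabulate⁺ P {suc n} f all = cong₂ _∧_ (all zero) (allB-tabulate⁺ P (f ∘ suc) (all ∘ suc))

anyB-tabulate⁻ : {A : Set} (P : A → Bool) {n : ℕ} (f : Fin n → A) → anyB P (tabulate f) ≡ true → Σ (Fin n) λ i → P (f i) ≡ true
anyB-tabulate⁻ P {suc n} f any with P (f zero) in P0
... | true  = zero , P0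
... | false = let i , Pi = anyB-tabulate⁻ P (f ∘ suc) any in suc i , Pi

anyB-tabulate⁺ : {A : Set} (P : A → Bool) {n : ℕ} (f : Fin n → A) (i : Fin n) → P (f i) ≡ true → anyB P (tabulate f) ≡ true
anyB-tabulate⁺ P f zero    Pi rewrite Pi = refl
anyB-tabulate⁺ P f (suc i) Pi with P (f zero)
... | true  = refl
... | false = anyB-tabulate⁺ P (f ∘ suc) i Pi

firstOr : {A : Set} → A → (A → Bool) → List A → A
firstOr d Q []       = d
firstOr d Q (x ∷ xs) = if Q x then x else firstOr d Q xs

firstOr-satisfies : {A : Set} (d : A) (Q : A → Bool) (xs : List A) → anyB Q xs ≡ true → Q (firstOr d Q xs) ≡ true
firstOr-satisfies d Q (x ∷ xs) any with Q x in Qx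
... | true  = Qx
... | false = firstOr-satisfies d Q xs any

record Equinumerous {A B : Set} (P : A → Bool) (Q : B → Bool) : Set where
  field
    to      : A → B
    from    : B → A
    to-Q    : ∀ a → P a ≡ true → Q (to a) ≡ true
    from-P  : ∀ b → Q b ≡ true → P (from b) ≡ true
    from∘to : ∀ a → P a ≡ true → from (to a) ≡ a
    to∘from : ∀ b → Q b ≡ true → to (from b) ≡ b

module _ {A B : Set} (_≟ᴬ_ : DecidableEquality A) (_≟ᴮ_ : DecidableEquality B) where
  open Enumeration _≟ᴬ_ using () renaming (_==_ to _==ᴬ_; Enumerates to Enumeratesᴬ; ==-refl to ==ᴬ-refl)
  open Enumeration _≟ᴮ_ using () renaming (_==_ to _==ᴮ_; Enumerates to Enumeratesᴮ)

  -- Both sides equal the number of pairs (a , b) with P a and b = to a, equivalently Q b and a = from b.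
  count-equinumerous : {LA : List A} {LB : List B} → Enumeratesᴬ LA → Enumeratesᴮ LB →
    {P : A → Bool} {Q : B → Bool} → Equinumerous P Q → count P LA ≡ count Q LB
  count-equinumerous {LA} {LB} enumA enumB {P} {Q} P≃Q = begin
      count P LA
        ≡⟨ count≡sumL-ind P LA ⟩
      sumL (ind ∘ P) LA
        ≡⟨ sumL-cong LA (λ a → sym (Enumeration.sumL-*-ind _≟ᴮ_ enumB (ind (P a)) (to a))) ⟩
      sumL (λ a → sumL (λ b → ind (P a) * ind (b ==ᴮ to a)) LB) LA
        ≡⟨ sumL-swap _ LA LB ⟩
      sumL (λ b → sumL (λ a → ind (P a) * ind (b ==ᴮ to a)) LA) LB
        ≡⟨ sumL-cong LB (λ b → sumL-cong LA (λ a → graph a b)) ⟩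
      sumL (λ b → sumL (λ a → ind (Q b) * ind (a ==ᴬ from b)) LA) LB
        ≡⟨ sumL-cong LB (λ b → Enumeration.sumL-*-ind _≟ᴬ_ enumA (ind (Q b)) (from b)) ⟩
      sumL (ind ∘ Q) LB
        ≡⟨ sym (count≡sumL-ind Q LB) ⟩
      count Q LB ∎
    where
    open ≡-Reasoning
    open Equinumerous P≃Q
    graph : ∀ a b → ind (P a) * ind (b ==ᴮ to a) ≡ ind (Q b) * ind (a ==ᴬ from b)
    graph a b with P a in Pa | b ≟ᴮ to a
    ... | true  | yes refl rewrite to-Q a Pa | from∘to a Pa | ==ᴬ-refl a = refl
    ... | true  | no b≢ta with Q b in Qb | a ≟ᴬ from b
    ...   | true  | yes refl = ⊥-elim (b≢ta (sym (to∘from b Qb)))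
    ...   | true  | no _     = refl
    ...   | false | _        = refl
    graph a b | false | _ with Q b in Qb | a ≟ᴬ from b
    ...   | true  | yes refl = ⊥-elim (false≢true (trans (sym Pa) (from-P b Qb)))
    ...   | true  | no _     = refl
    ...   | false | _        = refl

StrictTotalᵇ : {A : Set} → (A → A → Bool) → Set
StrictTotalᵇ {A} lt = (∀ a → lt a a ≡ false) × (∀ a b → a ≢ b → ind (lt a b) + ind (lt b a) ≡ 1)

-- Each orbit {a , σ a} is counted once through its lt-smaller element and once through its larger one.
count-involution-even : {A : Set} (_≟_ : DecidableEquality A) {L : List A} → Enumeration.Enumerates _≟_ L →
  {lt : A → A → Bool} → StrictTotalᵇ lt → (P : A → Bool) (σ : A → A) →
  (∀ a → P a ≡ true → P (σ a) ≡ true) → (∀ a → P a ≡ true → σ (σ a) ≡ a) → (∀ a → P a ≡ true → σ a ≢ a) →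
  2 ∣ count P L
count-involution-even {A} _≟_ {L} enum {lt} (_ , trichotomy) P σ Pσ σσ σ≢id =
  divides (count lower L) (begin
    count P L                                     ≡⟨ count≡sumL-ind P L ⟩
    sumL (ind ∘ P) L                              ≡⟨ sumL-cong L split ⟩
    sumL (λ a → ind (lower a) + ind (upper a)) L  ≡⟨ sumL-+ _ _ L ⟩
    sumL (ind ∘ lower) L + sumL (ind ∘ upper) L   ≡⟨ cong₂ _+_ (sym (count≡sumL-ind lower L)) (sym (count≡sumL-ind upper L)) ⟩
    count lower L + count upper L                 ≡⟨ cong (count lower L +_) (sym lower≡upper) ⟩
    count lower L + count lower L                 ≡⟨ cong (count lower L +_) (sym (+-identityʳ _)) ⟩
    2 * count lower L                             ≡⟨ *-comm 2 (count lower L) ⟩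
    count lower L * 2                             ∎)
  where
  open ≡-Reasoning
  lower upper : A → Bool
  lower a = P a ∧ lt a (σ a)
  upper a = P a ∧ lt (σ a) a
  split : ∀ a → ind (P a) ≡ ind (lower a) + ind (upper a)
  split a with P a in Pa
  ... | true  = sym (trichotomy a (σ a) (λ a≡σa → σ≢id a Pa (sym a≡σa)))
  ... | false = refl
  swap : ∀ a → lower a ≡ true → upper (σ a) ≡ true
  swap a low rewrite Pσ a (∧-conicalˡ (P a) _ low) | σσ a (∧-conicalˡ (P a) _ low) = ∧-conicalʳ (P a) _ low
  swap⁻ : ∀ a → upper a ≡ true → lower (σ a) ≡ true
  swap⁻ a up rewrite Pσ a (∧-conicalˡ (P a) _ up) | σσ a (∧-conicalˡ (P a) _ up) = ∧-conicalʳ (P a) _ up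
  lower≡upper : count lower L ≡ count upper L
  lower≡upper = count-equinumerous _≟_ _≟_ enum enum record
    { to = σ ; from = σ ; to-Q = swap ; from-P = swap⁻
    ; from∘to = λ a low → σσ a (∧-conicalˡ (P a) _ low) ; to∘from = λ a up → σσ a (∧-conicalˡ (P a) _ up) }

allFin-once : ∀ n (c : Fin n) → sumL (λ x → ind (Enumeration._==_ Fin._≟_ x c)) (allFin n) ≡ 1
allFin-once (suc n) zero = cong suc (begin
    sumL (λ x → ind (x == zero)) (tabulate {n = n} suc)                 ≡⟨ cong (sumL _) (sym (map-tabulate {n = n} id suc)) ⟩
    sumL (λ x → ind (x == zero)) (map {B = Fin (suc n)} suc (allFin n)) ≡⟨ sumL-map _ suc (allFin n) ⟩
    sumL (λ _ → 0) (allFin n)                                           ≡⟨ sumL-zero (allFin n) ⟩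
    0                                                                   ∎)
  where
  open ≡-Reasoning
  _==_ : ∀ {m} → Fin m → Fin m → Bool
  _==_ = Enumeration._==_ Fin._≟_
allFin-once (suc n) (suc c) = begin
    sumL (λ x → ind (x == suc c)) (tabulate {n = n} suc)                 ≡⟨ cong (sumL _) (sym (map-tabulate {n = n} id suc)) ⟩
    sumL (λ x → ind (x == suc c)) (map {B = Fin (suc n)} suc (allFin n)) ≡⟨ sumL-map _ suc (allFin n) ⟩
    sumL (λ x → ind (suc x == suc c)) (allFin n)                         ≡⟨ sumL-cong (allFin n) (λ x → cong ind (suc-== x)) ⟩
    sumL (λ x → ind (x == c)) (allFin n)                                 ≡⟨ allFin-once n c ⟩
    1                                                                    ∎
  where
  open ≡-Reasoning
  _==_ : ∀ {m} → Fin m → Fin m → Bool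
  _==_ = Enumeration._==_ Fin._≟_
  suc-== : ∀ x → (suc x == suc c) ≡ (x == c)
  suc-== x with x Fin.≟ c
  ... | yes _ = refl
  ... | no _  = refl

allFin-enumerates : ∀ n → Enumeration.Enumerates (Fin._≟_ {n}) (allFin n)
allFin-enumerates n = record { exactly-once = allFin-once n }

allVec-once : {A : Set} (_≟_ : DecidableEquality A) {xs : List A} → Enumeration.Enumerates _≟_ xs →
  ∀ k (cs : Vec A k) → sumL (λ v → ind (Enumeration._==_ (Vec.≡-dec _≟_) v cs)) (allVec xs k) ≡ 1
allVec-once _≟_ enum zero    []       = refl
allVec-once {A} _≟_ {xs} enum (suc k) (c ∷ cs) = begin
    sumL (λ v → ind (v ==ᵛ (c ∷ cs))) (concatMap (λ x → map (x ∷_) (allVec xs k)) xs)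
      ≡⟨ sumL-concatMap _ _ xs ⟩
    sumL (λ x → sumL (λ v → ind (v ==ᵛ (c ∷ cs))) (map (x ∷_) (allVec xs k))) xs
      ≡⟨ sumL-cong xs (λ x → sumL-map _ (x ∷_) (allVec xs k)) ⟩
    sumL (λ x → sumL (λ v → ind ((x ∷ v) ==ᵛ (c ∷ cs))) (allVec xs k)) xs
      ≡⟨ sumL-cong xs (λ x → sumL-cong (allVec xs k) (cons-== x)) ⟩
    sumL (λ x → sumL (λ v → ind (x == c) * ind (v ==ᵛ cs)) (allVec xs k)) xs
      ≡⟨ sumL-cong xs (λ x → trans (sumL-*ˡ (ind (x == c)) _ (allVec xs k))
                               (trans (cong (ind (x == c) *_) (allVec-once _≟_ enum k cs)) (*-identityʳ _))) ⟩
    sumL (λ x → ind (x == c)) xs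
      ≡⟨ Enumeration.exactly-once enum c ⟩
    1 ∎
  where
  open ≡-Reasoning
  open Enumeration _≟_
  _==ᵛ_ : ∀ {m} → Vec A m → Vec A m → Bool
  _==ᵛ_ = Enumeration._==_ (Vec.≡-dec _≟_)
  cons-== : ∀ x v → ind ((x ∷ v) ==ᵛ (c ∷ cs)) ≡ ind (x == c) * ind (v ==ᵛ cs)
  cons-== x v with x ≟ c | Vec.≡-dec _≟_ v cs
  ... | yes _ | yes _ = refl
  ... | yes _ | no _  = refl
  ... | no _  | _     = refl

allVec-enumerates : {A : Set} (_≟_ : DecidableEquality A) {xs : List A} → Enumeration.Enumerates _≟_ xs →
  ∀ k → Enumeration.Enumerates (Vec.≡-dec {n = k} _≟_) (allVec xs k)
allVec-enumerates _≟_ enum k = record { exactly-once = allVec-once _≟_ enum k }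

_<ᶠ_ : ∀ {n} → Fin n → Fin n → Bool
x <ᶠ y = ⌊ x Fin.<? y ⌋

<ᶠ-strictTotal : ∀ {n} → StrictTotalᵇ (_<ᶠ_ {n})
<ᶠ-strictTotal = irreflexive , trichotomy
  where
  irreflexive : ∀ a → (a <ᶠ a) ≡ false
  irreflexive a with a Fin.<? a
  ... | yes a<a = ⊥-elim (Fin.<-irrefl refl a<a)
  ... | no _    = refl
  trichotomy : ∀ a b → a ≢ b → ind (a <ᶠ b) + ind (b <ᶠ a) ≡ 1
  trichotomy a b a≢b with a Fin.<? b | b Fin.<? a
  ... | yes a<b | yes b<a = ⊥-elim (Fin.<-asym a<b b<a)
  ... | yes _   | no _    = refl
  ... | no _    | yes _   = refl
  ... | no a≮b  | no b≮a  with Fin.<-cmp a b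
  ...   | tri< a<b _ _   = ⊥-elim (a≮b a<b)
  ...   | tri≈ _ a≡b _   = ⊥-elim (a≢b a≡b)
  ...   | tri> _ _ b<a   = ⊥-elim (b≮a b<a)

module Lexicographic {A : Set} (_≟_ : DecidableEquality A) {lt : A → A → Bool} (lt-total : StrictTotalᵇ lt) where
  open Enumeration _≟_

  lex : ∀ {k} → Vec A k → Vec A k → Bool
  lex []       []       = false
  lex (x ∷ xs) (y ∷ ys) = lt x y ∨ ((x == y) ∧ lex xs ys)

  lex-≡head : ∀ {k x y} → x ≡ y → (xs ys : Vec A k) → lex (x ∷ xs) (y ∷ ys) ≡ lex xs ys
  lex-≡head {x = x} refl xs ys rewrite proj₁ lt-total x | ==-refl x = refl

  lex-≢head : ∀ {k x y} → x ≢ y → (xs ys : Vec A k) → lex (x ∷ xs) (y ∷ ys) ≡ lt x y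
  lex-≢head {x = x} {y} x≢y xs ys rewrite ==-≢ x≢y = ∨-identityʳ (lt x y)

  lex-strictTotal : ∀ {k} → StrictTotalᵇ (lex {k})
  lex-strictTotal = irreflexive , trichotomy
    where
    irreflexive : ∀ {k} (a : Vec A k) → lex a a ≡ false
    irreflexive []       = refl
    irreflexive (x ∷ xs) = trans (lex-≡head refl xs xs) (irreflexive xs)
    trichotomy : ∀ {k} (a b : Vec A k) → a ≢ b → ind (lex a b) + ind (lex b a) ≡ 1
    trichotomy []       []       []≢[] = ⊥-elim ([]≢[] refl)
    trichotomy (x ∷ xs) (y ∷ ys) ne = by-head (x ≟ y)
      where
      by-head : Dec (x ≡ y) → ind (lex (x ∷ xs) (y ∷ ys)) + ind (lex (y ∷ ys) (x ∷ xs)) ≡ 1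
      by-head (yes x≡y) = trans (cong₂ (λ p q → ind p + ind q) (lex-≡head x≡y xs ys) (lex-≡head (sym x≡y) ys xs))
                                (trichotomy xs ys (λ xs≡ys → ne (cong₂ _∷_ x≡y xs≡ys)))
      by-head (no x≢y)  = trans (cong₂ (λ p q → ind p + ind q) (lex-≢head x≢y xs ys) (lex-≢head (x≢y ∘ sym) ys xs))
                                (proj₂ lt-total x y x≢y)

injective⇒surjective : ∀ {m} (f : Fin m → Fin m) → (∀ i j → f i ≡ f j → i ≡ j) → ∀ x → Σ (Fin m) λ i → f i ≡ x
injective⇒surjective {suc m} f inj x with Fin.any? (λ i → f i Fin.≟ x)
... | yes hit  = hit
... | no  miss = ⊥-elim (<-irrefl refl (Fin.injective⇒≤ {f = avoid} avoid-injective))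
  where
  avoid : Fin (suc m) → Fin m
  avoid i = punchOut {i = x} {j = f i} (λ x≡fi → miss (i , sym x≡fi))
  avoid-injective : ∀ {i j} → avoid i ≡ avoid j → i ≡ j
  avoid-injective {i} {j} eq = inj i j (Fin.punchOut-injective (λ x≡fi → miss (i , sym x≡fi)) (λ x≡fj → miss (j , sym x≡fj)) eq)

count-∘-injective : ∀ {m} (f : Fin m → Fin m) → (∀ i j → f i ≡ f j → i ≡ j) → (Q : Fin m → Bool) →
  count (Q ∘ f) (allFin m) ≡ count Q (allFin m)
count-∘-injective {m} f inj Q = count-equinumerous Fin._≟_ Fin._≟_ (allFin-enumerates m) (allFin-enumerates m) record
  { to = f ; from = f⁻¹ ; to-Q = λ _ Qfi → Qfi ; from-P = λ x Qx → subst (λ y → Q y ≡ true) (sym (f∘f⁻¹ x)) Qx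
  ; from∘to = λ i _ → inj _ _ (f∘f⁻¹ (f i)) ; to∘from = λ x _ → f∘f⁻¹ x }
  where
  f⁻¹ : Fin m → Fin m
  f⁻¹ x = proj₁ (injective⇒surjective f inj x)
  f∘f⁻¹ : ∀ x → f (f⁻¹ x) ≡ x
  f∘f⁻¹ x = proj₂ (injective⇒surjective f inj x)

count≤length : {A : Set} (P : A → Bool) (xs : List A) → count P xs ≤ length xs
count≤length P []       = z≤n
count≤length P (x ∷ xs) with P x
... | true  = s≤s (count≤length P xs)
... | false = ≤-trans (count≤length P xs) (n≤1+n _)

-- Hamilton cycles and the degrees of H

module Hamiltonian (G : Graph) where

  N : ℕ
  N = n G

  V : List (Fin N)
  V = allFin N

  edgeSets : List (EdgeSet N)
  edgeSets = allEdgeSets N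

  open Enumeration (Fin._≟_ {N}) public using (_==_; ==-refl; ==-≢; ==-sound)

  V-enum : Enumeration.Enumerates Fin._≟_ V
  V-enum = allFin-enumerates N

  EdgesOk : EdgeSet N → Set
  EdgesOk D = ∀ x y → (D ∋ₑ x , y) ≡ true → (D ∋ₑ y , x) ≡ true × adj G x y ≡ true

  DegreesTwo : EdgeSet N → Set
  DegreesTwo D = ∀ x → count (λ y → D ∋ₑ x , y) V ≡ 2

  Connected : EdgeSet N → Set
  Connected D = ∀ x y → reach G D N x y ≡ true

  private
    edgesᵇ degreesᵇ connectedᵇ : EdgeSet N → Bool
    edgesᵇ D     = allB (λ x → allB (λ y → if D ∋ₑ x , y then (D ∋ₑ y , x) ∧ adj G x y else true) V) V
    degreesᵇ D   = allB (λ x → ⌊ count (λ y → D ∋ₑ x , y) V Data.Nat.≟ 2 ⌋) V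
    connectedᵇ D = allB (λ x → allB (λ y → reach G D N x y) V) V

  isHamCycle⇒edgesOk : ∀ D → isHamCycle G D ≡ true → EdgesOk D
  isHamCycle⇒edgesOk D ham x y Dxy = ∧-conicalˡ (D ∋ₑ y , x) _ both , ∧-conicalʳ (D ∋ₑ y , x) _ both
    where
    checked : (if D ∋ₑ x , y then (D ∋ₑ y , x) ∧ adj G x y else true) ≡ true
    checked = allB-tabulate⁻ _ id (allB-tabulate⁻ _ id (∧-conicalˡ (edgesᵇ D) _ ham) x) y
    both : ((D ∋ₑ y , x) ∧ adj G x y) ≡ true
    both = subst (λ b → (if b then (D ∋ₑ y , x) ∧ adj G x y else true) ≡ true) Dxy checked

  isHamCycle⇒degreesTwo : ∀ D → isHamCycle G D ≡ true → DegreesTwo D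
  isHamCycle⇒degreesTwo D ham x =
    toWitness (≡true⇒T (allB-tabulate⁻ _ id (∧-conicalˡ (degreesᵇ D) _ (∧-conicalʳ (edgesᵇ D) _ ham)) x))

  isHamCycle⇒connected : ∀ D → isHamCycle G D ≡ true → Connected D
  isHamCycle⇒connected D ham x =
    allB-tabulate⁻ _ id (allB-tabulate⁻ _ id (∧-conicalʳ (degreesᵇ D) _ (∧-conicalʳ (edgesᵇ D) _ ham)) x)

  isHamCycle-intro : ∀ D → EdgesOk D → DegreesTwo D → Connected D → isHamCycle G D ≡ true
  isHamCycle-intro D edges degrees connected =
    cong₂ _∧_ (allB-tabulate⁺ _ id λ x → allB-tabulate⁺ _ id (edge-ok x))
      (cong₂ _∧_ (allB-tabulate⁺ _ id λ x → T⇒≡true (fromWitness (degrees x)))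
                 (allB-tabulate⁺ _ id λ x → allB-tabulate⁺ _ id (connected x)))
    where
    edge-ok : ∀ x y → (if D ∋ₑ x , y then (D ∋ₑ y , x) ∧ adj G x y else true) ≡ true
    edge-ok x y with D ∋ₑ x , y in Dxy
    ... | true  = let Dyx , Axy = edges x y Dxy in cong₂ _∧_ Dyx Axy
    ... | false = refl

  module _ (D : EdgeSet N) (ham : isHamCycle G D ≡ true) (s : Fin N) where

    ham-neighbours : Σ (Fin N) λ c → Σ (Fin N) λ d → c ≢ d × (D ∋ₑ s , c) ≡ true × (D ∋ₑ s , d) ≡ true ×
      (∀ x → (D ∋ₑ s , x) ≡ true → x ≡ c ⊎ x ≡ d)
    ham-neighbours = Enumeration.count≡2⇒two Fin._≟_ V-enum _ (isHamCycle⇒degreesTwo D ham s)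

  hamThrough : Fin N → Fin N → ℕ
  hamThrough s x = count (λ D → isHamCycle G D ∧ (D ∋ₑ s , x)) edgeSets

  hamThrough₂ : Fin N → Fin N → Fin N → ℕ
  hamThrough₂ s a b = count (λ D → isHamCycle G D ∧ ((D ∋ₑ s , a) ∧ (D ∋ₑ s , b))) edgeSets

  hamCount : ℕ
  hamCount = count (isHamCycle G) edgeSets

  sumL-pairs2 : (s : Fin N) (g : Fin N × Fin N → ℕ) →
    sumL g (pairs2 G s) ≡ sumL (λ a → sumL (λ b → ind (adj G s a ∧ adj G s b ∧ (a <ᶠ b)) * g (a , b)) V) V
  sumL-pairs2 s g = begin
      sumL g (concatMap (λ a → concatMap (λ b → pair a b) V) V)   ≡⟨ sumL-concatMap g _ V ⟩
      sumL (λ a → sumL g (concatMap (λ b → pair a b) V)) V       ≡⟨ sumL-cong V (λ a → sumL-concatMap g _ V) ⟩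
      sumL (λ a → sumL (λ b → sumL g (pair a b)) V) V
        ≡⟨ sumL-cong V (λ a → sumL-cong V (λ b → sumL-if g (adj G s a ∧ adj G s b ∧ (a <ᶠ b)) (a , b))) ⟩
      sumL (λ a → sumL (λ b → ind (adj G s a ∧ adj G s b ∧ (a <ᶠ b)) * g (a , b)) V) V ∎
    where
    open ≡-Reasoning
    pair : Fin N → Fin N → List (Fin N × Fin N)
    pair a b = if adj G s a ∧ adj G s b ∧ (a <ᶠ b) then (a , b) ∷ [] else []

  sumL-increasing-pairs : (S : Fin N → Bool) {c d : Fin N} → c ≢ d → S c ≡ true → S d ≡ true →
    (∀ x → S x ≡ true → x ≡ c ⊎ x ≡ d) →
    sumL (λ a → ind (S a) * sumL (λ b → ind (S b) * ind (a <ᶠ b)) V) V ≡ 1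
  sumL-increasing-pairs S {c} {d} c≢d Sc Sd only-c-d = begin
      sumL (λ a → ind (S a) * above a) V
        ≡⟨ Enumeration.sumL-pair Fin._≟_ V-enum _ c d c≢d (λ x x≢c x≢d → cong (λ t → ind t * above x) (outside x x≢c x≢d)) ⟩
      ind (S c) * above c + ind (S d) * above d
        ≡⟨ cong₂ _+_ (at-member Sc) (at-member Sd) ⟩
      ind (c <ᶠ c) + ind (c <ᶠ d) + (ind (d <ᶠ c) + ind (d <ᶠ d))
        ≡⟨ cong₂ (λ p q → ind p + ind (c <ᶠ d) + (ind (d <ᶠ c) + ind q)) (proj₁ <ᶠ-strictTotal c) (proj₁ <ᶠ-strictTotal d) ⟩
      ind (c <ᶠ d) + (ind (d <ᶠ c) + 0)
        ≡⟨ cong (ind (c <ᶠ d) +_) (+-identityʳ _) ⟩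
      ind (c <ᶠ d) + ind (d <ᶠ c)
        ≡⟨ proj₂ <ᶠ-strictTotal c d c≢d ⟩
      1 ∎
    where
    open ≡-Reasoning
    outside : ∀ x → x ≢ c → x ≢ d → S x ≡ false
    outside x x≢c x≢d with S x in Sx
    ... | false = refl
    ... | true with only-c-d x Sx
    ...   | inj₁ x≡c = ⊥-elim (x≢c x≡c)
    ...   | inj₂ x≡d = ⊥-elim (x≢d x≡d)
    one* : ∀ {x} m → S x ≡ true → ind (S x) * m ≡ m
    one* m Sx = trans (cong (λ t → ind t * m) Sx) (+-identityʳ m)
    above : Fin N → ℕ
    above a = sumL (λ b → ind (S b) * ind (a <ᶠ b)) V
    above≡ : ∀ a → above a ≡ ind (a <ᶠ c) + ind (a <ᶠ d)
    above≡ a = trans (Enumeration.sumL-pair Fin._≟_ V-enum _ c d c≢d (λ x x≢c x≢d → cong (λ t → ind t * ind (a <ᶠ x)) (outside x x≢c x≢d)))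
                     (cong₂ _+_ (one* _ Sc) (one* _ Sd))
    at-member : ∀ {x} → S x ≡ true → ind (S x) * above x ≡ ind (x <ᶠ c) + ind (x <ᶠ d)
    at-member Sx = trans (one* _ Sx) (above≡ _)

  ham-pairs2-unique : ∀ D → isHamCycle G D ≡ true → ∀ s →
    sumL (λ cd → ind ((D ∋ₑ s , proj₁ cd) ∧ (D ∋ₑ s , proj₂ cd))) (pairs2 G s) ≡ 1
  ham-pairs2-unique D ham s = begin
      sumL (λ cd → ind (S (proj₁ cd) ∧ S (proj₂ cd))) (pairs2 G s)
        ≡⟨ sumL-pairs2 s _ ⟩
      sumL (λ a → sumL (λ b → ind (adj G s a ∧ adj G s b ∧ (a <ᶠ b)) * ind (S a ∧ S b)) V) V
        ≡⟨ sumL-cong V (λ a → trans (sumL-cong V (in-cycle a)) (sumL-*ˡ (ind (S a)) _ V)) ⟩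
      sumL (λ a → ind (S a) * sumL (λ b → ind (S b) * ind (a <ᶠ b)) V) V
        ≡⟨ increasing-pair (ham-neighbours D ham s) ⟩
      1 ∎
    where
    open ≡-Reasoning
    S : Fin N → Bool
    S y = D ∋ₑ s , y
    increasing-pair : (Σ (Fin N) λ c → Σ (Fin N) λ d → c ≢ d × S c ≡ true × S d ≡ true × (∀ x → S x ≡ true → x ≡ c ⊎ x ≡ d)) →
      sumL (λ a → ind (S a) * sumL (λ b → ind (S b) * ind (a <ᶠ b)) V) V ≡ 1
    increasing-pair (c , d , c≢d , Sc , Sd , only-c-d) = sumL-increasing-pairs S c≢d Sc Sd only-c-d
    in-cycle : ∀ a b → ind (adj G s a ∧ adj G s b ∧ (a <ᶠ b)) * ind (S a ∧ S b) ≡ ind (S a) * (ind (S b) * ind (a <ᶠ b))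
    in-cycle a b with S a in Sa | S b in Sb
    ... | false | _     = *-zeroʳ (ind (adj G s a ∧ adj G s b ∧ (a <ᶠ b)))
    ... | true  | false = *-zeroʳ (ind (adj G s a ∧ adj G s b ∧ (a <ᶠ b)))
    ... | true  | true  rewrite proj₂ (isHamCycle⇒edgesOk D ham s a Sa) | proj₂ (isHamCycle⇒edgesOk D ham s b Sb) =
      trans (*-identityʳ _) (sym (trans (+-identityʳ _) (+-identityʳ _)))

  sumL-pairs2-count : (s : Fin N) (Q : EdgeSet N → Bool) (F : Fin N × Fin N → EdgeSet N → Bool) →
    (∀ cd D → ind (F cd D) ≡ ind (isHamCycle G D ∧ Q D) * ind ((D ∋ₑ s , proj₁ cd) ∧ (D ∋ₑ s , proj₂ cd))) →
    sumL (λ cd → count (F cd) edgeSets) (pairs2 G s) ≡ count (λ D → isHamCycle G D ∧ Q D) edgeSets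
  sumL-pairs2-count s Q F factor = begin
      sumL (λ cd → count (F cd) edgeSets) (pairs2 G s)
        ≡⟨ sumL-cong (pairs2 G s) (λ cd → count≡sumL-ind (F cd) edgeSets) ⟩
      sumL (λ cd → sumL (λ D → ind (F cd D)) edgeSets) (pairs2 G s)
        ≡⟨ sumL-swap _ (pairs2 G s) edgeSets ⟩
      sumL (λ D → sumL (λ cd → ind (F cd D)) (pairs2 G s)) edgeSets
        ≡⟨ sumL-cong edgeSets per-cycle ⟩
      sumL (λ D → ind (isHamCycle G D ∧ Q D)) edgeSets
        ≡⟨ sym (count≡sumL-ind _ edgeSets) ⟩
      count (λ D → isHamCycle G D ∧ Q D) edgeSets ∎
    where
    open ≡-Reasoning
    uses : EdgeSet N → Fin N × Fin N → ℕ
    uses D (c , d) = ind ((D ∋ₑ s , c) ∧ (D ∋ₑ s , d))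
    per-cycle : ∀ D → sumL (λ cd → ind (F cd D)) (pairs2 G s) ≡ ind (isHamCycle G D ∧ Q D)
    per-cycle D with isHamCycle G D in ham
    ... | false = trans (sumL-cong (pairs2 G s) (λ cd → trans (factor cd D) (cong (λ h → ind (h ∧ Q D) * uses D cd) ham))) (sumL-zero (pairs2 G s))
    ... | true  = begin
        sumL (λ cd → ind (F cd D)) (pairs2 G s)
          ≡⟨ sumL-cong (pairs2 G s) (λ cd → trans (factor cd D) (cong (λ h → ind (h ∧ Q D) * uses D cd) ham)) ⟩
        sumL (λ cd → ind (Q D) * ind ((D ∋ₑ s , proj₁ cd) ∧ (D ∋ₑ s , proj₂ cd))) (pairs2 G s)
          ≡⟨ sumL-*ˡ (ind (Q D)) _ (pairs2 G s) ⟩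
        ind (Q D) * sumL (λ cd → ind ((D ∋ₑ s , proj₁ cd) ∧ (D ∋ₑ s , proj₂ cd))) (pairs2 G s)
          ≡⟨ cong (ind (Q D) *_) (ham-pairs2-unique D ham s) ⟩
        ind (Q D) * 1
          ≡⟨ *-identityʳ _ ⟩
        ind (Q D) ∎

  multᵇ : (v w a b c d : Fin N) → EdgeSet N → Bool
  multᵇ v w a b c d D = isHamCycle G D ∧ (D ∋ₑ v , a) ∧ (D ∋ₑ v , b) ∧ (D ∋ₑ w , c) ∧ (D ∋ₑ w , d)

  degHˡ≡hamThrough₂ : ∀ v w (p : Pair2 G v) → degHˡ G v w p ≡ hamThrough₂ v (proj₁ p) (proj₁ (proj₂ p))
  degHˡ≡hamThrough₂ v w (a , b , _) =
    sumL-pairs2-count w (λ D → (D ∋ₑ v , a) ∧ (D ∋ₑ v , b)) (λ { (c , d) → multᵇ v w a b c d })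
      λ { (c , d) D → ind-∧-factorˡ (isHamCycle G D) (D ∋ₑ v , a) (D ∋ₑ v , b) ((D ∋ₑ w , c) ∧ (D ∋ₑ w , d)) }

  degHʳ≡hamThrough₂ : ∀ v w (q : Pair2 G w) → degHʳ G v w q ≡ hamThrough₂ w (proj₁ q) (proj₁ (proj₂ q))
  degHʳ≡hamThrough₂ v w (c , d , _) =
    sumL-pairs2-count v (λ D → (D ∋ₑ w , c) ∧ (D ∋ₑ w , d)) (λ { (a , b) → multᵇ v w a b c d })
      λ { (a , b) D → ind-∧-factorʳ (isHamCycle G D) (D ∋ₑ v , a) (D ∋ₑ v , b) ((D ∋ₑ w , c) ∧ (D ∋ₑ w , d)) }

  -- A Hamilton cycle uses exactly two of the three edges sa, sb, sk: it avoids sk iff it uses both sa and sb.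
  hamThrough₂+hamThrough≡hamCount : ∀ {s a b k} → a ≢ b → a ≢ k → b ≢ k →
    (∀ x → adj G s x ≡ true → x ≡ a ⊎ x ≡ b ⊎ x ≡ k) →
    hamThrough₂ s a b + hamThrough s k ≡ hamCount
  hamThrough₂+hamThrough≡hamCount {s} {a} {b} {k} a≢b a≢k b≢k neighbours = begin
      hamThrough₂ s a b + hamThrough s k
        ≡⟨ cong₂ _+_ (count≡sumL-ind _ edgeSets) (count≡sumL-ind _ edgeSets) ⟩
      sumL (λ D → ind (isHamCycle G D ∧ (S D a ∧ S D b))) edgeSets + sumL (λ D → ind (isHamCycle G D ∧ S D k)) edgeSets
        ≡⟨ sym (sumL-+ _ _ edgeSets) ⟩
      sumL (λ D → ind (isHamCycle G D ∧ (S D a ∧ S D b)) + ind (isHamCycle G D ∧ S D k)) edgeSets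
        ≡⟨ sumL-cong edgeSets (λ D → ind-∧-sum (isHamCycle G D) _ _ (one-pair-or-third D)) ⟩
      sumL (ind ∘ isHamCycle G) edgeSets
        ≡⟨ sym (count≡sumL-ind _ edgeSets) ⟩
      hamCount ∎
    where
    open ≡-Reasoning
    S : EdgeSet N → Fin N → Bool
    S D y = D ∋ₑ s , y
    one-pair-or-third : ∀ D → isHamCycle G D ≡ true → ind (S D a ∧ S D b) + ind (S D k) ≡ 1
    one-pair-or-third D ham = ind-two-of-three (S D a) (S D b) (S D k) (begin
        ind (S D a) + ind (S D b) + ind (S D k)
          ≡⟨ sym (Enumeration.sumL-triple Fin._≟_ V-enum (ind ∘ S D) a b k a≢b a≢k b≢k off-cycle) ⟩
        sumL (ind ∘ S D) V
          ≡⟨ sym (count≡sumL-ind (S D) V) ⟩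
        count (S D) V
          ≡⟨ isHamCycle⇒degreesTwo D ham s ⟩
        2 ∎)
      where
      off-cycle : ∀ x → x ≢ a → x ≢ b → x ≢ k → ind (S D x) ≡ 0
      off-cycle x x≢a x≢b x≢k with S D x in Sx
      ... | false = refl
      ... | true with neighbours x (proj₂ (isHamCycle⇒edgesOk D ham s x Sx))
      ...   | inj₁ x≡a        = ⊥-elim (x≢a x≡a)
      ...   | inj₂ (inj₁ x≡b) = ⊥-elim (x≢b x≡b)
      ...   | inj₂ (inj₂ x≡k) = ⊥-elim (x≢k x≡k)

-- Smith's theorem: Hamilton paths and Pósa rotations

-- Pósa rotation of positions 0 … N-1 at k: keep 0 … k, reverse k+1 … N-1.
reverseAfter : ℕ → ℕ → ℕ → ℕ
reverseAfter N k i = if i ≤ᵇ k then i else N + k ∸ i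

module _ {N : ℕ} where

  reverseAfter-≤ : ∀ {k i} → i ≤ k → reverseAfter N k i ≡ i
  reverseAfter-≤ {k} {i} i≤k = cong (λ b → if b then i else N + k ∸ i) (≤ᵇ-true i≤k)

  reverseAfter-+ : ∀ {k i} → k < i → i < N → reverseAfter N k i + i ≡ N + k
  reverseAfter-+ {k} {i} k<i i<N =
    trans (cong (λ b → (if b then i else N + k ∸ i) + i) (≤ᵇ-false (<⇒≱ k<i)))
          (m∸n+n≡m (≤-trans (<⇒≤ i<N) (m≤m+n N k)))

  reverseAfter-< : ∀ {k i} → i < N → reverseAfter N k i < N
  reverseAfter-< {k} {i} i<N with i ≤? k
  ... | yes i≤k = subst (_< N) (sym (reverseAfter-≤ i≤k)) i<N
  ... | no  i≰k = +-cancelʳ-< i _ N (subst (_< N + i) (sym (reverseAfter-+ (≰⇒> i≰k) i<N)) (+-monoʳ-< N (≰⇒> i≰k)))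

  reverseAfter-> : ∀ {k i} → k < i → i < N → k < reverseAfter N k i
  reverseAfter-> {k} {i} k<i i<N =
    +-cancelʳ-< i k _ (subst (k + i <_) (sym (reverseAfter-+ k<i i<N)) (subst (_< N + k) (+-comm i k) (+-monoˡ-< k i<N)))

  reverseAfter-involutive : ∀ {k i} → i < N → reverseAfter N k (reverseAfter N k i) ≡ i
  reverseAfter-involutive {k} {i} i<N with i ≤? k
  ... | yes i≤k = trans (cong (reverseAfter N k) (reverseAfter-≤ i≤k)) (reverseAfter-≤ i≤k)
  ... | no  i≰k = +-cancelʳ-≡ (reverseAfter N k i) _ i
        (trans (reverseAfter-+ (reverseAfter-> k<i i<N) (reverseAfter-< i<N))
               (trans (sym (reverseAfter-+ k<i i<N)) (+-comm (reverseAfter N k i) i)))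
    where k<i = ≰⇒> i≰k

  reverseAfter-suc : ∀ {k j} → k < j → suc j < N → reverseAfter N k j ≡ suc (reverseAfter N k (suc j))
  reverseAfter-suc {k} {j} k<j 1+j<N = +-cancelʳ-≡ j _ _
    (trans (reverseAfter-+ k<j (<-trans (n<1+n j) 1+j<N))
           (trans (sym (reverseAfter-+ (<-trans k<j (n<1+n j)) 1+j<N)) (+-suc (reverseAfter N k (suc j)) j)))

reverseAfter-1+k : ∀ {ℓ k} → suc k < suc ℓ → reverseAfter (suc ℓ) k (suc k) ≡ ℓ
reverseAfter-1+k {ℓ} {k} 1+k<N = +-cancelʳ-≡ (suc k) _ ℓ
  (trans (reverseAfter-+ (n<1+n k) 1+k<N) (sym (+-suc ℓ k)))

reverseAfter-last : ∀ {ℓ k} → suc k < suc ℓ → reverseAfter (suc ℓ) k ℓ ≡ suc k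
reverseAfter-last {ℓ} {k} 1+k<N = +-cancelʳ-≡ ℓ _ (suc k)
  (trans (reverseAfter-+ (≤-pred 1+k<N) (n<1+n ℓ)) (trans (+-comm (suc ℓ) k) (+-suc k ℓ)))

∸≡suc[∸suc] : ∀ a b → b < a → a ∸ b ≡ suc (a ∸ suc b)
∸≡suc[∸suc] (suc a) zero    _         = refl
∸≡suc[∸suc] (suc a) (suc b) (s≤s b<a) = ∸≡suc[∸suc] a b b<a

module HamiltonPaths (M : ℕ) (adjG : Fin (3 + M) → Fin (3 + M) → Bool)
  (symG : ∀ x y → adjG x y ≡ adjG y x) (irreflG : ∀ x → adjG x x ≡ false)
  (cubic : ∀ x → count (adjG x) (allFin (3 + M)) ≡ 3) (u v : Fin (3 + M)) where

  G : Graph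
  G = record { n = 3 + M ; adj = adjG ; sym = symG ; irrefl = irreflG }

  open Hamiltonian G public

  ℓ : ℕ
  ℓ = 2 + M

  ℓ<N : ℓ < N
  ℓ<N = n<1+n ℓ

  -- index j is the position j when j < N, and a junk value otherwise; abstract to keep terms small.
  abstract
    index : ℕ → Fin N
    index j with j <? N
    ... | yes j<N = fromℕ< j<N
    ... | no  _   = zero

    toℕ-index : ∀ {j} → j < N → toℕ (index j) ≡ j
    toℕ-index {j} j<N with j <? N
    ... | yes j<N′ = Fin.toℕ-fromℕ< j<N′
    ... | no  j≮N  = ⊥-elim (j≮N j<N)

  index-toℕ : ∀ (i : Fin N) → index (toℕ i) ≡ i
  index-toℕ i = Fin.toℕ-injective (toℕ-index (Fin.toℕ<n i))

  Seq : Set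
  Seq = Vec (Fin N) N

  at : Seq → ℕ → Fin N
  at P j = lookup P (index j)

  at-toℕ : ∀ P (i : Fin N) → at P (toℕ i) ≡ lookup P i
  at-toℕ P i = cong (lookup P) (index-toℕ i)

  endpoint : Seq → Fin N
  endpoint P = at P ℓ

  record IsHamPath (P : Seq) : Set where
    field
      starts-u  : at P 0 ≡ u
      starts-v  : at P 1 ≡ v
      injective : ∀ i j → i < N → j < N → at P i ≡ at P j → i ≡ j
      adjacent  : ∀ j → suc j < N → adjG (at P j) (at P (suc j)) ≡ true

    lookup-injective : ∀ i j → lookup P i ≡ lookup P j → i ≡ j
    lookup-injective i j eq = Fin.toℕ-injective
      (injective _ _ (Fin.toℕ<n i) (Fin.toℕ<n j) (trans (at-toℕ P i) (trans eq (sym (at-toℕ P j)))))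

    at-surjective : ∀ x → Σ ℕ λ j → j < N × at P j ≡ x
    at-surjective x with injective⇒surjective (lookup P) lookup-injective x
    ... | i , Pi≡x = toℕ i , Fin.toℕ<n i , trans (at-toℕ P i) Pi≡x

  distinctᵇ : Seq → Fin N → Fin N → Bool
  distinctᵇ P i j = (i == j) ∨ not (lookup P i == lookup P j)

  stepᵇ : Seq → Fin N → Bool
  stepᵇ P i = not (suc (toℕ i) <ᵇ N) ∨ adjG (lookup P i) (at P (suc (toℕ i)))

  isHamPathᵇ : Seq → Bool
  isHamPathᵇ P = (at P 0 == u) ∧ (at P 1 == v) ∧ allB (λ i → allB (distinctᵇ P i) V) V ∧ allB (stepᵇ P) V

  isHamPathᵇ⇒IsHamPath : ∀ P → isHamPathᵇ P ≡ true → IsHamPath P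
  isHamPathᵇ⇒IsHamPath P holds = record
    { starts-u  = ==-sound (∧-conicalˡ (at P 0 == u) _ holds)
    ; starts-v  = ==-sound (∧-conicalˡ (at P 1 == v) _ holds₁)
    ; injective = injective
    ; adjacent  = adjacent }
    where
    injectiveᵇ : Bool
    injectiveᵇ = allB (λ i → allB (distinctᵇ P i) V) V
    holds₁ : ((at P 1 == v) ∧ injectiveᵇ ∧ allB (stepᵇ P) V) ≡ true
    holds₁ = ∧-conicalʳ (at P 0 == u) _ holds
    holds₂ : (injectiveᵇ ∧ allB (stepᵇ P) V) ≡ true
    holds₂ = ∧-conicalʳ (at P 1 == v) _ holds₁
    lookup-injective : ∀ i j → lookup P i ≡ lookup P j → i ≡ j
    lookup-injective i j eq
      with ∨-true (allB-tabulate⁻ (distinctᵇ P i) id (allB-tabulate⁻ (λ i → allB (distinctᵇ P i) V) id (∧-conicalˡ injectiveᵇ _ holds₂) i) j)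
    ... | inj₁ i==j    = ==-sound i==j
    ... | inj₂ Pi=/=Pj = ⊥-elim (false≢true (trans (sym (not-true Pi=/=Pj)) (subst (λ y → (lookup P i == y) ≡ true) eq (==-refl _))))
    injective : ∀ i j → i < N → j < N → at P i ≡ at P j → i ≡ j
    injective i j i<N j<N eq =
      trans (sym (toℕ-index i<N)) (trans (cong toℕ (lookup-injective (index i) (index j) eq)) (toℕ-index j<N))
    adjacent : ∀ j → suc j < N → adjG (at P j) (at P (suc j)) ≡ true
    adjacent j 1+j<N with ∨-true (allB-tabulate⁻ (stepᵇ P) id (∧-conicalʳ injectiveᵇ _ holds₂) (index j))
    ... | inj₁ last = ⊥-elim (false≢true (trans (sym (not-true last))
                        (<ᵇ-true (subst (λ z → suc z < N) (sym (toℕ-index (<-trans (n<1+n j) 1+j<N))) 1+j<N))))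
    ... | inj₂ adj = subst (λ z → adjG (at P j) (at P (suc z)) ≡ true) (toℕ-index (<-trans (n<1+n j) 1+j<N)) adj

  IsHamPath⇒isHamPathᵇ : ∀ P → IsHamPath P → isHamPathᵇ P ≡ true
  IsHamPath⇒isHamPathᵇ P path =
    cong₂ _∧_ (subst (λ x → (at P 0 == x) ≡ true) starts-u (==-refl _))
      (cong₂ _∧_ (subst (λ x → (at P 1 == x) ≡ true) starts-v (==-refl _))
        (cong₂ _∧_ (allB-tabulate⁺ (λ i → allB (distinctᵇ P i) V) id λ i → allB-tabulate⁺ (distinctᵇ P i) id (distinct i))
                   (allB-tabulate⁺ (stepᵇ P) id adjacentᵇ)))
    where
    open IsHamPath path
    distinct : ∀ i j → distinctᵇ P i j ≡ true
    distinct i j with i Fin.≟ j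
    ... | yes _   = refl
    ... | no  i≢j = not-false (==-≢ (i≢j ∘ lookup-injective i j))
    adjacentᵇ : ∀ i → stepᵇ P i ≡ true
    adjacentᵇ i with suc (toℕ i) <? N
    ... | yes 1+i<N = subst (λ b → (not b ∨ adjG (lookup P i) (at P (suc (toℕ i)))) ≡ true) (sym (<ᵇ-true 1+i<N))
                        (subst (λ z → adjG z (at P (suc (toℕ i))) ≡ true) (at-toℕ P i) (adjacent (toℕ i) 1+i<N))
    ... | no  1+i≮N = subst (λ b → (not b ∨ adjG (lookup P i) (at P (suc (toℕ i)))) ≡ true) (sym (<ᵇ-false 1+i≮N)) refl

  rotate : Seq → ℕ → Seq
  rotate P k = Vec.tabulate (λ i → at P (reverseAfter N k (toℕ i)))

  at-rotate : ∀ P k {j} → j < N → at (rotate P k) j ≡ at P (reverseAfter N k j)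
  at-rotate P k {j} j<N = trans (Vec.lookup∘tabulate (λ i → at P (reverseAfter N k (toℕ i))) (index j))
                                (cong (λ z → at P (reverseAfter N k z)) (toℕ-index j<N))

  -- Pósa: if the endpoint of P is adjacent to P k, then P 0 … P k, P ℓ, P (ℓ-1), … P (k+1) is again a Hamilton path.
  module PosaRotation (P : Seq) (path : IsHamPath P) {k : ℕ} (1≤k : 1 ≤ k) (k≤M : k ≤ M)
    (chord : adjG (at P k) (endpoint P) ≡ true) where
    open IsHamPath path

    private
      k<N : k < N
      k<N = ≤-trans (s≤s k≤M) (≤-trans (n≤1+n (suc M)) (n≤1+n ℓ))

      1+k<N : suc k < N
      1+k<N = s≤s (≤-trans (s≤s k≤M) (n≤1+n (suc M)))

      at-rotate-ℓ : at (rotate P k) ℓ ≡ at P (suc k)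
      at-rotate-ℓ = trans (at-rotate P k ℓ<N) (cong (at P) (reverseAfter-last 1+k<N))

      at-rotate-k : at (rotate P k) k ≡ at P k
      at-rotate-k = trans (at-rotate P k k<N) (cong (at P) (reverseAfter-≤ {N = N} ≤-refl))

    rotate-isHamPath : IsHamPath (rotate P k)
    rotate-isHamPath = record
      { starts-u  = trans (at-rotate P k (s≤s z≤n)) (trans (cong (at P) (reverseAfter-≤ {N = N} {k} z≤n)) starts-u)
      ; starts-v  = trans (at-rotate P k (s≤s (s≤s z≤n))) (trans (cong (at P) (reverseAfter-≤ {N = N} 1≤k)) starts-v)
      ; injective = rotated-injective
      ; adjacent  = rotated-adjacent }
      where
      rotated-injective : ∀ i j → i < N → j < N → at (rotate P k) i ≡ at (rotate P k) j → i ≡ j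
      rotated-injective i j i<N j<N eq =
        trans (sym (reverseAfter-involutive i<N))
          (trans (cong (reverseAfter N k)
                   (injective _ _ (reverseAfter-< i<N) (reverseAfter-< j<N)
                      (trans (sym (at-rotate P k i<N)) (trans eq (at-rotate P k j<N)))))
                 (reverseAfter-involutive j<N))
      adjacent-before : ∀ {j} → Tri (j < k) (j ≡ k) (k < j) → suc j < N →
        adjG (at P (reverseAfter N k j)) (at P (reverseAfter N k (suc j))) ≡ true
      adjacent-before {j} (tri< j<k _ _) 1+j<N =
        subst₂ (λ a b → adjG (at P a) (at P b) ≡ true) (sym (reverseAfter-≤ {N = N} (<⇒≤ j<k))) (sym (reverseAfter-≤ {N = N} j<k)) (adjacent j 1+j<N)
      adjacent-before {j} (tri≈ _ refl _) 1+j<N =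
        subst₂ (λ a b → adjG (at P a) (at P b) ≡ true) (sym (reverseAfter-≤ {N = N} ≤-refl)) (sym (reverseAfter-1+k 1+j<N)) chord
      adjacent-before {j} (tri> _ _ k<j) 1+j<N =
        subst (λ a → adjG (at P a) (at P (reverseAfter N k (suc j))) ≡ true) (sym (reverseAfter-suc k<j 1+j<N))
          (trans (symG _ _) (adjacent _ (subst (_< N) (reverseAfter-suc k<j 1+j<N) (reverseAfter-< (<-trans (n<1+n j) 1+j<N)))))
      rotated-adjacent : ∀ j → suc j < N → adjG (at (rotate P k) j) (at (rotate P k) (suc j)) ≡ true
      rotated-adjacent j 1+j<N =
        subst₂ (λ a b → adjG a b ≡ true) (sym (at-rotate P k (<-trans (n<1+n j) 1+j<N))) (sym (at-rotate P k 1+j<N))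
          (adjacent-before (<-cmp j k) 1+j<N)

    rotate-chord : adjG (at (rotate P k) k) (endpoint (rotate P k)) ≡ true
    rotate-chord = subst₂ (λ a b → adjG a b ≡ true) (sym at-rotate-k) (sym at-rotate-ℓ) (adjacent k 1+k<N)

    rotate-involutive : rotate (rotate P k) k ≡ P
    rotate-involutive = trans (Vec.tabulate-cong twice) (Vec.tabulate∘lookup P)
      where
      twice : ∀ i → at (rotate P k) (reverseAfter N k (toℕ i)) ≡ lookup P i
      twice i = trans (at-rotate P k (reverseAfter-< (Fin.toℕ<n i)))
                      (trans (cong (at P) (reverseAfter-involutive (Fin.toℕ<n i))) (at-toℕ P i))

    rotate-≢ : rotate P k ≢ P
    rotate-≢ eq = <-irrefl refl (≤-trans (s≤s (s≤s k≤M)) (≤-reflexive (sym 1+k≡ℓ)))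
      where
      1+k≡ℓ : suc k ≡ ℓ
      1+k≡ℓ = injective _ _ 1+k<N ℓ<N (trans (sym at-rotate-ℓ) (cong endpoint eq))

  -- A position k together with a sequence P is encoded as the vector k ∷ P, so that allVec enumerates such pairs.
  interiorᵇ : Fin N → Bool
  interiorᵇ k = not (k == index 0) ∧ not (k == index (suc M))

  rotatableᵇ : Vec (Fin N) (suc N) → Bool
  rotatableᵇ (k ∷ P) = isHamPathᵇ P ∧ (interiorᵇ k ∧ adjG (lookup P k) (endpoint P))

  rotateAt : Vec (Fin N) (suc N) → Vec (Fin N) (suc N)
  rotateAt (k ∷ P) = k ∷ rotate P (toℕ k)

  module Rotatable (k : Fin N) (P : Seq) (rotatable : rotatableᵇ (k ∷ P) ≡ true) where
    path : IsHamPath P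
    path = isHamPathᵇ⇒IsHamPath P (∧-conicalˡ (isHamPathᵇ P) _ rotatable)

    interior : interiorᵇ k ≡ true
    interior = ∧-conicalˡ (interiorᵇ k) _ (∧-conicalʳ (isHamPathᵇ P) _ rotatable)

    chord : adjG (at P (toℕ k)) (endpoint P) ≡ true
    chord = subst (λ y → adjG y (endpoint P) ≡ true) (sym (at-toℕ P k)) (∧-conicalʳ (interiorᵇ k) _ (∧-conicalʳ (isHamPathᵇ P) _ rotatable))

    private
      ≢index : ∀ {j} → not (k == index j) ≡ true → toℕ k ≢ j
      ≢index k=/=j refl = false≢true (trans (sym (cong not (==-refl k))) (subst (λ z → not (k == z) ≡ true) (index-toℕ k) k=/=j))

    1≤k : 1 ≤ toℕ k
    1≤k = n≢0⇒n>0 (≢index (∧-conicalˡ (not (k == index 0)) _ interior))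

    k≤M : toℕ k ≤ M
    k≤M = ≤-pred (≤∧≢⇒< (≤-pred (≤∧≢⇒< (≤-pred (Fin.toℕ<n k)) k≢ℓ)) k≢1+M)
      where
      k≢1+M : toℕ k ≢ suc M
      k≢1+M = ≢index (∧-conicalʳ (not (k == index 0)) _ interior)
      k≢ℓ : toℕ k ≢ ℓ
      k≢ℓ k≡ℓ = false≢true (trans (sym (irreflG (endpoint P))) (subst (λ j → adjG (at P j) (endpoint P) ≡ true) k≡ℓ chord))

    open PosaRotation P path 1≤k k≤M chord public

  rotatable-rotateAt : ∀ a → rotatableᵇ a ≡ true → rotatableᵇ (rotateAt a) ≡ true
  rotatable-rotateAt (k ∷ P) rotatable =
    cong₂ _∧_ (IsHamPath⇒isHamPathᵇ _ rotate-isHamPath)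
      (cong₂ _∧_ interior (subst (λ y → adjG y (endpoint (rotate P (toℕ k))) ≡ true) (at-toℕ (rotate P (toℕ k)) k) rotate-chord))
    where open Rotatable k P rotatable

  rotateAt-involutive : ∀ a → rotatableᵇ a ≡ true → rotateAt (rotateAt a) ≡ a
  rotateAt-involutive (k ∷ P) rotatable = cong (k ∷_) rotate-involutive
    where open Rotatable k P rotatable

  rotateAt-≢ : ∀ a → rotatableᵇ a ≡ true → rotateAt a ≢ a
  rotateAt-≢ (k ∷ P) rotatable eq = rotate-≢ (Vec.∷-injectiveʳ eq)
    where open Rotatable k P rotatable

  rotatable-even : 2 ∣ count rotatableᵇ (allVec V (suc N))
  rotatable-even = count-involution-even (Vec.≡-dec Fin._≟_) (allVec-enumerates Fin._≟_ V-enum (suc N))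
    {lt = Lexicographic.lex Fin._≟_ {_<ᶠ_} <ᶠ-strictTotal} (Lexicographic.lex-strictTotal Fin._≟_ {_<ᶠ_} <ᶠ-strictTotal) rotatableᵇ rotateAt
    rotatable-rotateAt rotateAt-involutive rotateAt-≢

  closingᵇ : Seq → Bool
  closingᵇ P = isHamPathᵇ P ∧ adjG u (endpoint P)

  -- The three neighbours of the endpoint sit at position 0 (iff P closes up), at position ℓ-1, and at interior chords.
  rotations+closing≡2 : ∀ P → isHamPathᵇ P ≡ true → sumL (λ k → ind (rotatableᵇ (k ∷ P))) V + ind (closingᵇ P) ≡ 2
  rotations+closing≡2 P isPath = +-cancelʳ-≡ 1 _ _ (begin
      R + ind (closingᵇ P) + 1
        ≡⟨ cong (λ b → R + ind (b ∧ adjG u x) + 1) isPath ⟩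
      R + ind (adjG u x) + 1
        ≡⟨ cong₂ (λ c p → R + c + p) (sym first) (sym predecessor) ⟩
      R + sumL at-first V + sumL at-predecessor V
        ≡⟨ cong (_+ sumL at-predecessor V) (sym (sumL-+ rotations at-first V)) ⟩
      sumL (λ k → rotations k + at-first k) V + sumL at-predecessor V
        ≡⟨ sym (sumL-+ (λ k → rotations k + at-first k) at-predecessor V) ⟩
      sumL (λ k → rotations k + at-first k + at-predecessor k) V
        ≡⟨ sym (sumL-cong V split) ⟩
      sumL (ind ∘ a) V
        ≡⟨ endpoint-degree ⟩
      3 ∎)
    where
    open ≡-Reasoning
    open IsHamPath (isHamPathᵇ⇒IsHamPath P isPath)
    x : Fin N
    x = endpoint P
    a : Fin N → Bool
    a k = adjG (lookup P k) x
    rotations at-first at-predecessor : Fin N → ℕ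
    rotations k       = ind (rotatableᵇ (k ∷ P))
    at-first k        = ind ((k == index 0) ∧ a k)
    at-predecessor k  = ind ((k == index (suc M)) ∧ a k)
    R : ℕ
    R = sumL rotations V
    endpoint-degree : sumL (ind ∘ a) V ≡ 3
    endpoint-degree = begin
        sumL (ind ∘ a) V                   ≡⟨ sym (count≡sumL-ind a V) ⟩
        count a V                          ≡⟨ count-∘-injective (lookup P) lookup-injective (λ y → adjG y x) ⟩
        count (λ y → adjG y x) V           ≡⟨ count≡sumL-ind (λ y → adjG y x) V ⟩
        sumL (λ y → ind (adjG y x)) V      ≡⟨ sumL-cong V (λ y → cong ind (symG y x)) ⟩
        sumL (ind ∘ adjG x) V              ≡⟨ sym (count≡sumL-ind (adjG x) V) ⟩
        count (adjG x) V                   ≡⟨ cubic x ⟩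
        3                                  ∎
    at-position : ∀ c → sumL (λ k → ind ((k == c) ∧ a k)) V ≡ ind (a c)
    at-position c = trans (Enumeration.sumL-single Fin._≟_ V-enum _ c (λ k k≢c → cong (λ b → ind (b ∧ a k)) (==-≢ k≢c)))
                          (cong (λ b → ind (b ∧ a c)) (==-refl c))
    first : sumL at-first V ≡ ind (adjG u x)
    first = trans (at-position (index 0)) (cong (λ y → ind (adjG y x)) starts-u)
    predecessor : sumL at-predecessor V ≡ 1
    predecessor = trans (at-position (index (suc M))) (cong ind (adjacent (suc M) ℓ<N))
    split : ∀ k → ind (a k) ≡ rotations k + at-first k + at-predecessor k
    split k rewrite isPath = ind-split-positions (k == index 0) (k == index (suc M)) (a k) first≠predecessor
      where
      first≠predecessor : (k == index 0) ≡ true → (k == index (suc M)) ≡ false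
      first≠predecessor k=0 = ==-≢ λ k≡1+M → 0≢1+n (trans (sym (toℕ-index (s≤s z≤n)))
        (trans (cong toℕ (trans (sym (==-sound k=0)) k≡1+M)) (toℕ-index (≤-trans (n<1+n (suc M)) (n≤1+n ℓ)))))

  closing-even : 2 ∣ count closingᵇ (allVec V N)
  closing-even = ∣m+n∣m⇒∣n (subst (2 ∣_) (sym total) (divides paths (*-comm 2 paths))) rotatable-even
    where
    open ≡-Reasoning
    Seqs : List Seq
    Seqs = allVec V N
    paths : ℕ
    paths = count isHamPathᵇ Seqs
    per-sequence : ∀ P → sumL (λ k → ind (rotatableᵇ (k ∷ P))) V + ind (closingᵇ P) ≡ 2 * ind (isHamPathᵇ P)
    per-sequence P = by-path (isHamPathᵇ P) refl
      where
      by-path : ∀ b → isHamPathᵇ P ≡ b → sumL (λ k → ind (rotatableᵇ (k ∷ P))) V + ind (closingᵇ P) ≡ 2 * ind b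
      by-path true  isPath  = rotations+closing≡2 P isPath
      by-path false notPath = cong₂ _+_
        (trans (sumL-cong V (λ k → cong (λ b → ind (b ∧ (interiorᵇ k ∧ adjG (lookup P k) (endpoint P)))) notPath)) (sumL-zero V))
        (cong (λ b → ind (b ∧ adjG u (endpoint P))) notPath)
    total : count rotatableᵇ (allVec V (suc N)) + count closingᵇ Seqs ≡ 2 * count isHamPathᵇ Seqs
    total = begin
        count rotatableᵇ (allVec V (suc N)) + count closingᵇ Seqs
          ≡⟨ cong₂ _+_ (count≡sumL-ind rotatableᵇ (allVec V (suc N))) (count≡sumL-ind closingᵇ Seqs) ⟩
        sumL (ind ∘ rotatableᵇ) (concatMap (λ k → map (k ∷_) Seqs) V) + sumL (ind ∘ closingᵇ) Seqs
          ≡⟨ cong (_+ sumL (ind ∘ closingᵇ) Seqs) (trans (sumL-concatMap (ind ∘ rotatableᵇ) (λ k → map (k ∷_) Seqs) V)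
                                                         (sumL-cong V (λ k → sumL-map (ind ∘ rotatableᵇ) (k ∷_) Seqs))) ⟩
        sumL (λ k → sumL (λ P → ind (rotatableᵇ (k ∷ P))) Seqs) V + sumL (ind ∘ closingᵇ) Seqs
          ≡⟨ cong (_+ sumL (ind ∘ closingᵇ) Seqs) (sumL-swap _ V Seqs) ⟩
        sumL (λ P → sumL (λ k → ind (rotatableᵇ (k ∷ P))) V) Seqs + sumL (ind ∘ closingᵇ) Seqs
          ≡⟨ sym (sumL-+ _ _ Seqs) ⟩
        sumL (λ P → sumL (λ k → ind (rotatableᵇ (k ∷ P))) V + ind (closingᵇ P)) Seqs
          ≡⟨ sumL-cong Seqs per-sequence ⟩
        sumL (λ P → 2 * ind (isHamPathᵇ P)) Seqs
          ≡⟨ sumL-*ˡ 2 _ Seqs ⟩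
        2 * sumL (ind ∘ isHamPathᵇ) Seqs
          ≡⟨ cong (2 *_) (sym (count≡sumL-ind isHamPathᵇ Seqs)) ⟩
        2 * count isHamPathᵇ Seqs ∎

  next : ℕ → ℕ
  next j = if suc j <ᵇ N then suc j else 0

  prev : ℕ → ℕ
  prev zero    = ℓ
  prev (suc j) = j

  next-suc : ∀ {j} → suc j < N → next j ≡ suc j
  next-suc {j} 1+j<N = cong (λ b → if b then suc j else 0) (<ᵇ-true 1+j<N)

  next-ℓ : next ℓ ≡ 0
  next-ℓ = cong (λ b → if b then suc ℓ else 0) (<ᵇ-false {N} (<-irrefl refl))

  suc<N⊎≡ℓ : ∀ {j} → j < N → suc j < N ⊎ j ≡ ℓ
  suc<N⊎≡ℓ {j} j<N with suc j <? N
  ... | yes 1+j<N = inj₁ 1+j<N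
  ... | no  1+j≮N = inj₂ (≤-antisym (≤-pred j<N) (≤-pred (≤-pred (≰⇒> 1+j≮N))))

  next-< : ∀ {j} → j < N → next j < N
  next-< j<N with suc<N⊎≡ℓ j<N
  ... | inj₁ 1+j<N = subst (_< N) (sym (next-suc 1+j<N)) 1+j<N
  ... | inj₂ refl  = subst (_< N) (sym next-ℓ) (s≤s z≤n)

  prev-< : ∀ {j} → j < N → prev j < N
  prev-< {zero}  _     = ℓ<N
  prev-< {suc j} 1+j<N = <-trans (n<1+n j) 1+j<N

  prev-next : ∀ {j} → j < N → prev (next j) ≡ j
  prev-next j<N with suc<N⊎≡ℓ j<N
  ... | inj₁ 1+j<N = cong prev (next-suc 1+j<N)
  ... | inj₂ refl  = cong prev next-ℓ

  next-prev : ∀ {j} → j < N → next (prev j) ≡ j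
  next-prev {zero}  _     = next-ℓ
  next-prev {suc j} 1+j<N = next-suc 1+j<N

  next≢prev : ∀ {j} → j < N → next j ≢ prev j
  next≢prev {zero}  _ eq = 1+n≢0 (suc-injective (trans (sym eq) (next-suc (s≤s (s≤s z≤n)))))
  next≢prev {suc j} 1+j<N eq with suc<N⊎≡ℓ 1+j<N
  ... | inj₁ 2+j<N = <⇒≢ (≤-trans (n<1+n j) (n≤1+n (suc j))) (sym (trans (sym (next-suc 2+j<N)) eq))
  ... | inj₂ 1+j≡ℓ = 1+n≢0 (trans (suc-injective (sym 1+j≡ℓ)) (trans (sym eq) (trans (cong next 1+j≡ℓ) next-ℓ)))

  SameEdge : Fin N → Fin N → Fin N → Fin N → Set
  SameEdge x y a b = (x ≡ a × y ≡ b) ⊎ (x ≡ b × y ≡ a)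

  sameEdgeᵇ : Fin N → Fin N → Fin N → Fin N → Bool
  sameEdgeᵇ x y a b = ((x == a) ∧ (y == b)) ∨ ((x == b) ∧ (y == a))

  sameEdgeᵇ⇒SameEdge : ∀ x y a b → sameEdgeᵇ x y a b ≡ true → SameEdge x y a b
  sameEdgeᵇ⇒SameEdge x y a b same with ∨-true {(x == a) ∧ (y == b)} same
  ... | inj₁ xa∧yb = inj₁ (==-sound (∧-conicalˡ (x == a) _ xa∧yb) , ==-sound (∧-conicalʳ (x == a) _ xa∧yb))
  ... | inj₂ xb∧ya = inj₂ (==-sound (∧-conicalˡ (x == b) _ xb∧ya) , ==-sound (∧-conicalʳ (x == b) _ xb∧ya))

  SameEdge⇒sameEdgeᵇ : ∀ x y a b → SameEdge x y a b → sameEdgeᵇ x y a b ≡ true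
  SameEdge⇒sameEdgeᵇ x y a b (inj₁ (refl , refl)) rewrite ==-refl x | ==-refl y = refl
  SameEdge⇒sameEdgeᵇ x y a b (inj₂ (refl , refl)) rewrite ==-refl x | ==-refl y = ∨-zeroʳ _

  SameEdge-swap : ∀ {x y a b} → SameEdge x y a b → SameEdge y x a b
  SameEdge-swap (inj₁ (x≡a , y≡b)) = inj₂ (y≡b , x≡a)
  SameEdge-swap (inj₂ (x≡b , y≡a)) = inj₁ (y≡a , x≡b)

  -- The edges P j (P (j+1)) for j < N, indices taken mod N: the path closed up into a cycle.
  cycleEdgeᵇ : Seq → Fin N → Fin N → Bool
  cycleEdgeᵇ P x y = anyB (λ i → sameEdgeᵇ x y (lookup P i) (at P (next (toℕ i)))) V

  cycleOf : Seq → EdgeSet N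
  cycleOf P = Vec.tabulate (λ x → Vec.tabulate (cycleEdgeᵇ P x))

  cycleOf-∋ : ∀ P x y → (cycleOf P ∋ₑ x , y) ≡ cycleEdgeᵇ P x y
  cycleOf-∋ P x y = trans (cong (λ row → lookup row y) (Vec.lookup∘tabulate (λ x → Vec.tabulate (cycleEdgeᵇ P x)) x))
                          (Vec.lookup∘tabulate (cycleEdgeᵇ P x) y)

  cycleEdgeᵇ-elim : ∀ P x y → cycleEdgeᵇ P x y ≡ true → Σ ℕ λ i → i < N × SameEdge x y (at P i) (at P (next i))
  cycleEdgeᵇ-elim P x y edge with anyB-tabulate⁻ (λ i → sameEdgeᵇ x y (lookup P i) (at P (next (toℕ i)))) id edge
  ... | i , same = toℕ i , Fin.toℕ<n i ,
    subst (λ z → SameEdge x y z (at P (next (toℕ i)))) (sym (at-toℕ P i)) (sameEdgeᵇ⇒SameEdge _ _ _ _ same)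

  cycleEdgeᵇ-intro : ∀ P x y {i} → i < N → SameEdge x y (at P i) (at P (next i)) → cycleEdgeᵇ P x y ≡ true
  cycleEdgeᵇ-intro P x y {i} i<N same =
    anyB-tabulate⁺ (λ i → sameEdgeᵇ x y (lookup P i) (at P (next (toℕ i)))) id (index i)
      (SameEdge⇒sameEdgeᵇ _ _ _ _ (subst (λ z → SameEdge x y (at P i) (at P (next z))) (sym (toℕ-index i<N)) same))

  cycleEdgeᵇ-sym : ∀ P x y → cycleEdgeᵇ P x y ≡ true → cycleEdgeᵇ P y x ≡ true
  cycleEdgeᵇ-sym P x y edge with cycleEdgeᵇ-elim P x y edge
  ... | i , i<N , same = cycleEdgeᵇ-intro P y x i<N (SameEdge-swap same)

  module CycleOfPath (P : Seq) (path : IsHamPath P) where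
    open IsHamPath path

    cycle-neighbours : ∀ {j} z → j < N → cycleEdgeᵇ P (at P j) z ≡ true → z ≡ at P (next j) ⊎ z ≡ at P (prev j)
    cycle-neighbours {j} z j<N edge with cycleEdgeᵇ-elim P (at P j) z edge
    ... | i , i<N , inj₁ (Pj≡Pi , z≡Pi+1) =
      inj₁ (trans z≡Pi+1 (cong (at P ∘ next) (sym (injective j i j<N i<N Pj≡Pi))))
    ... | i , i<N , inj₂ (Pj≡Pi+1 , z≡Pi) =
      inj₂ (trans z≡Pi (cong (at P) (trans (sym (prev-next i<N)) (cong prev (sym (injective j (next i) j<N (next-< i<N) Pj≡Pi+1))))))

    cycleEdge-next : ∀ {j} → j < N → cycleEdgeᵇ P (at P j) (at P (next j)) ≡ true
    cycleEdge-next j<N = cycleEdgeᵇ-intro P _ _ j<N (inj₁ (refl , refl))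

    cycleEdge-prev : ∀ {j} → j < N → cycleEdgeᵇ P (at P j) (at P (prev j)) ≡ true
    cycleEdge-prev j<N = cycleEdgeᵇ-intro P _ _ (prev-< j<N) (inj₂ (cong (at P) (sym (next-prev j<N)) , refl))

    cycle-degree : ∀ x → count (cycleEdgeᵇ P x) V ≡ 2
    cycle-degree x with at-surjective x
    ... | j , j<N , refl = begin
        count (cycleEdgeᵇ P (at P j)) V
          ≡⟨ count≡sumL-ind (cycleEdgeᵇ P (at P j)) V ⟩
        sumL (ind ∘ cycleEdgeᵇ P (at P j)) V
          ≡⟨ Enumeration.sumL-pair Fin._≟_ V-enum (ind ∘ cycleEdgeᵇ P (at P j)) (at P (next j)) (at P (prev j))
               (next≢prev j<N ∘ injective _ _ (next-< j<N) (prev-< j<N)) off-cycle ⟩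
        ind (cycleEdgeᵇ P (at P j) (at P (next j))) + ind (cycleEdgeᵇ P (at P j) (at P (prev j)))
          ≡⟨ cong₂ _+_ (cong ind (cycleEdge-next j<N)) (cong ind (cycleEdge-prev j<N)) ⟩
        2 ∎
      where
      open ≡-Reasoning
      off-cycle : ∀ z → z ≢ at P (next j) → z ≢ at P (prev j) → ind (cycleEdgeᵇ P (at P j) z) ≡ 0
      off-cycle z z≢next z≢prev with cycleEdgeᵇ P (at P j) z in edge
      ... | false = refl
      ... | true with cycle-neighbours z j<N edge
      ...   | inj₁ z≡next = ⊥-elim (z≢next z≡next)
      ...   | inj₂ z≡prev = ⊥-elim (z≢prev z≡prev)

  module Reachability (D : EdgeSet N) where

    reach-refl : ∀ x → reach G D 0 x x ≡ true
    reach-refl = ==-refl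

    reach-step : ∀ t x z y → reach G D t x z ≡ true → (D ∋ₑ z , y) ≡ true → reach G D (suc t) x y ≡ true
    reach-step t x z y x↝z zy =
      trans (cong (reach G D t x y ∨_) (anyB-tabulate⁺ (λ z → reach G D t x z ∧ (D ∋ₑ z , y)) id z (cong₂ _∧_ x↝z zy)))
                                      (∨-zeroʳ (reach G D t x y))

    reach-+ : ∀ d t x y → reach G D t x y ≡ true → reach G D (d + t) x y ≡ true
    reach-+ zero    t x y x↝y = x↝y
    reach-+ (suc d) t x y x↝y = cong (_∨ anyB (λ z → reach G D (d + t) x z ∧ (D ∋ₑ z , y)) V) (reach-+ d t x y x↝y)

    reach-≤N : ∀ t x y → t ≤ N → reach G D t x y ≡ true → reach G D N x y ≡ true
    reach-≤N t x y t≤N x↝y = subst (λ s → reach G D s x y ≡ true) (m∸n+n≡m t≤N) (reach-+ (N ∸ t) t x y x↝y)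

  module ClosingCycle (P : Seq) (closing : closingᵇ P ≡ true) where
    path : IsHamPath P
    path = isHamPathᵇ⇒IsHamPath P (∧-conicalˡ (isHamPathᵇ P) _ closing)
    open IsHamPath path
    open CycleOfPath P path
    open Reachability (cycleOf P)

    adjacent-cyclic : ∀ {i} → i < N → adjG (at P i) (at P (next i)) ≡ true
    adjacent-cyclic {i} i<N with suc<N⊎≡ℓ i<N
    ... | inj₁ 1+i<N = subst (λ z → adjG (at P i) (at P z) ≡ true) (sym (next-suc 1+i<N)) (adjacent i 1+i<N)
    ... | inj₂ refl  = subst (λ z → adjG (at P ℓ) (at P z) ≡ true) (sym next-ℓ)
                         (trans (symG _ _) (subst (λ z → adjG z (at P ℓ) ≡ true) (sym starts-u) (∧-conicalʳ (isHamPathᵇ P) _ closing)))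

    cycleEdge⇒adj : ∀ x y → cycleEdgeᵇ P x y ≡ true → adjG x y ≡ true
    cycleEdge⇒adj x y edge with cycleEdgeᵇ-elim P x y edge
    ... | i , i<N , inj₁ (refl , refl) = adjacent-cyclic i<N
    ... | i , i<N , inj₂ (refl , refl) = trans (symG _ _) (adjacent-cyclic i<N)

    forward : ∀ t i → i + t < N → reach G (cycleOf P) t (at P i) (at P (i + t)) ≡ true
    forward zero    i _ = subst (λ z → reach G (cycleOf P) 0 (at P i) (at P z) ≡ true) (sym (+-identityʳ i)) (reach-refl (at P i))
    forward (suc t) i i+t+1<N =
      reach-step t (at P i) (at P (i + t)) (at P (i + suc t)) (forward t i (<-trans (n<1+n _) 1+i+t<N))
        (trans (cycleOf-∋ P (at P (i + t)) (at P (i + suc t)))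
          (subst (λ z → cycleEdgeᵇ P (at P (i + t)) (at P z) ≡ true) (trans (next-suc 1+i+t<N) (sym (+-suc i t)))
                 (cycleEdge-next (<-trans (n<1+n _) 1+i+t<N))))
      where
      1+i+t<N : suc (i + t) < N
      1+i+t<N = subst (_< N) (+-suc i t) i+t+1<N

    backward : ∀ t i → t ≤ i → i < N → reach G (cycleOf P) t (at P i) (at P (i ∸ t)) ≡ true
    backward zero    i _   _   = reach-refl (at P i)
    backward (suc t) i t<i i<N =
      reach-step t (at P i) (at P (i ∸ t)) (at P (i ∸ suc t)) (backward t i (<⇒≤ t<i) i<N)
        (trans (cycleOf-∋ P (at P (i ∸ t)) (at P (i ∸ suc t)))
          (subst (λ z → cycleEdgeᵇ P (at P (i ∸ t)) (at P z) ≡ true) (cong prev (∸≡suc[∸suc] i t t<i))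
                 (cycleEdge-prev (≤-<-trans (m∸n≤m i t) i<N))))

    reach-positions : ∀ {i j} → i < N → j < N → reach G (cycleOf P) N (at P i) (at P j) ≡ true
    reach-positions {i} {j} i<N j<N = by-order (i ≤? j)
      where
      by-order : Dec (i ≤ j) → reach G (cycleOf P) N (at P i) (at P j) ≡ true
      by-order (yes i≤j) = reach-≤N (j ∸ i) _ _ (≤-trans (m∸n≤m j i) (<⇒≤ j<N))
        (subst (λ z → reach G (cycleOf P) (j ∸ i) (at P i) (at P z) ≡ true) (m+[n∸m]≡n i≤j)
               (forward (j ∸ i) i (subst (_< N) (sym (m+[n∸m]≡n i≤j)) j<N)))
      by-order (no i≰j) = reach-≤N (i ∸ j) _ _ (≤-trans (m∸n≤m i j) (<⇒≤ i<N))
        (subst (λ z → reach G (cycleOf P) (i ∸ j) (at P i) (at P z) ≡ true) (m∸[m∸n]≡n (<⇒≤ (≰⇒> i≰j)))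
               (backward (i ∸ j) i (m∸n≤m i j) i<N))

    cycle-connected : Connected (cycleOf P)
    cycle-connected x y = connect (at-surjective x) (at-surjective y)
      where
      connect : (Σ ℕ λ i → i < N × at P i ≡ x) → (Σ ℕ λ j → j < N × at P j ≡ y) → reach G (cycleOf P) N x y ≡ true
      connect (i , i<N , Pi≡x) (j , j<N , Pj≡y) =
        subst₂ (λ a b → reach G (cycleOf P) N a b ≡ true) Pi≡x Pj≡y (reach-positions i<N j<N)

    cycleOf-isHamCycle : isHamCycle G (cycleOf P) ≡ true
    cycleOf-isHamCycle = isHamCycle-intro (cycleOf P) edges-ok degrees cycle-connected
      where
      edges-ok : EdgesOk (cycleOf P)
      edges-ok x y xy = let edge = trans (sym (cycleOf-∋ P x y)) xy in
        trans (cycleOf-∋ P y x) (cycleEdgeᵇ-sym P x y edge) , cycleEdge⇒adj x y edge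
      degrees : DegreesTwo (cycleOf P)
      degrees x = trans (count≡sumL-ind (λ y → cycleOf P ∋ₑ x , y) V) (trans (sumL-cong V (λ y → cong ind (cycleOf-∋ P x y)))
                    (trans (sym (count≡sumL-ind (cycleEdgeᵇ P x) V)) (cycle-degree x)))

    cycleOf-uv : (cycleOf P ∋ₑ u , v) ≡ true
    cycleOf-uv = trans (cycleOf-∋ P u v)
      (subst₂ (λ a b → cycleEdgeᵇ P a b ≡ true) starts-u (trans (cong (at P) (next-suc (s≤s (s≤s z≤n)))) starts-v)
              (cycleEdge-next (s≤s z≤n)))

  nextOnCycle : EdgeSet N → Fin N → Fin N → Fin N
  nextOnCycle D p c = firstOr zero (λ z → (D ∋ₑ c , z) ∧ not (z == p)) V

  walkSteps : EdgeSet N → ℕ → Fin N × Fin N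
  walkSteps D zero    = u , v
  walkSteps D (suc t) = proj₂ (walkSteps D t) , nextOnCycle D (proj₁ (walkSteps D t)) (proj₂ (walkSteps D t))

  walkAt : EdgeSet N → ℕ → Fin N
  walkAt D t = proj₁ (walkSteps D t)

  walkOf : EdgeSet N → Seq
  walkOf D = Vec.tabulate (walkAt D ∘ toℕ)

  at-walkOf : ∀ D {j} → j < N → at (walkOf D) j ≡ walkAt D j
  at-walkOf D {j} j<N = trans (Vec.lookup∘tabulate (walkAt D ∘ toℕ) (index j)) (cong (walkAt D) (toℕ-index j<N))

  module WalkOfCycle (D : EdgeSet N) (ham : isHamCycle G D ≡ true) (D∋uv : (D ∋ₑ u , v) ≡ true) where

    private
      w : ℕ → Fin N
      w = walkAt D

    D-sym : ∀ x y → (D ∋ₑ x , y) ≡ true → (D ∋ₑ y , x) ≡ true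
    D-sym x y xy = proj₁ (isHamCycle⇒edgesOk D ham x y xy)

    D-≢ : ∀ x y → (D ∋ₑ x , y) ≡ true → x ≢ y
    D-≢ x .x xx refl = false≢true (trans (sym (irreflG x)) (proj₂ (isHamCycle⇒edgesOk D ham x x xx)))

    no-three-neighbours : ∀ x a b c → a ≢ b → a ≢ c → b ≢ c →
      (D ∋ₑ x , a) ≡ true → (D ∋ₑ x , b) ≡ true → (D ∋ₑ x , c) ≡ true → ⊥
    no-three-neighbours x = Enumeration.count≡2⇒no-three Fin._≟_ V-enum (λ y → D ∋ₑ x , y) (isHamCycle⇒degreesTwo D ham x)

    other-neighbour : ∀ c p → Σ (Fin N) λ z → ((D ∋ₑ c , z) ∧ not (z == p)) ≡ true
    other-neighbour c p = avoid (ham-neighbours D ham c)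
      where
      avoid : (Σ (Fin N) λ a → Σ (Fin N) λ b → a ≢ b × (D ∋ₑ c , a) ≡ true × (D ∋ₑ c , b) ≡ true ×
                (∀ x → (D ∋ₑ c , x) ≡ true → x ≡ a ⊎ x ≡ b)) →
        Σ (Fin N) λ z → ((D ∋ₑ c , z) ∧ not (z == p)) ≡ true
      avoid (a , b , a≢b , ca , cb , _) with a Fin.≟ p
      ... | yes refl = b , cong₂ _∧_ cb (not-false (==-≢ (a≢b ∘ sym)))
      ... | no  a≢p  = a , cong₂ _∧_ ca (not-false (==-≢ a≢p))

    nextOnCycle-spec : ∀ p c → ((D ∋ₑ c , nextOnCycle D p c) ∧ not (nextOnCycle D p c == p)) ≡ true
    nextOnCycle-spec p c = firstOr-satisfies zero (λ z → (D ∋ₑ c , z) ∧ not (z == p)) V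
      (anyB-tabulate⁺ (λ z → (D ∋ₑ c , z) ∧ not (z == p)) id (proj₁ (other-neighbour c p)) (proj₂ (other-neighbour c p)))

    walk-step : ∀ t → (D ∋ₑ w t , w (suc t)) ≡ true
    walk-step zero    = D∋uv
    walk-step (suc t) = ∧-conicalˡ (D ∋ₑ w (suc t) , w (suc (suc t))) _ (nextOnCycle-spec (w t) (w (suc t)))

    walk-no-backtrack : ∀ t → w (suc (suc t)) ≢ w t
    walk-no-backtrack t eq = false≢true (trans (sym (cong not (trans (cong (_== w t) eq) (==-refl (w t)))))
                                           (∧-conicalʳ (D ∋ₑ w (suc t) , w (suc (suc t))) _ (nextOnCycle-spec (w t) (w (suc t)))))

    walk-moves : ∀ t → w (suc t) ≢ w t
    walk-moves t eq = D-≢ (w t) (w (suc t)) (walk-step t) (sym eq)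

    DistinctUpTo : ℕ → Set
    DistinctUpTo T = ∀ i j → i ≤ T → j ≤ T → w i ≡ w j → i ≡ j

    distinct-≢ : ∀ {T i j} → DistinctUpTo T → i ≤ T → j ≤ T → i ≢ j → w i ≢ w j
    distinct-≢ distinct i≤T j≤T i≢j eq = i≢j (distinct _ _ i≤T j≤T eq)

    -- A repeated vertex w (T+1) = w (i+1) would have three neighbours w i, w (i+2), w T on the cycle.
    first-repeat-is-start : ∀ T → DistinctUpTo T → ∀ i → i ≤ T → w (suc T) ≡ w i → i ≡ 0
    first-repeat-is-start T distinct zero    _   _  = refl
    first-repeat-is-start T distinct (suc i) i<T eq = ⊥-elim (by-position (<-cmp (suc (suc i)) T))
      where
      i≤T : i ≤ T
      i≤T = ≤-trans (n≤1+n i) i<T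
      by-position : Tri (suc (suc i) < T) (suc (suc i) ≡ T) (T < suc (suc i)) → ⊥
      by-position (tri< 2+i<T _ _) = no-three-neighbours (w (suc i)) (w i) (w (suc (suc i))) (w T)
        (distinct-≢ distinct i≤T (<⇒≤ 2+i<T) (λ i≡2+i → <-irrefl i≡2+i (≤-trans (n<1+n i) (n≤1+n (suc i)))))
        (distinct-≢ distinct i≤T ≤-refl (λ i≡T → <-irrefl i≡T (<-trans (≤-trans (n<1+n i) (n≤1+n (suc i))) 2+i<T)))
        (distinct-≢ distinct (<⇒≤ 2+i<T) ≤-refl (λ 2+i≡T → <-irrefl 2+i≡T 2+i<T))
        (D-sym _ _ (walk-step i)) (walk-step (suc i))
        (D-sym (w T) (w (suc i)) (subst (λ z → (D ∋ₑ w T , z) ≡ true) eq (walk-step T)))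
      by-position (tri≈ _ 2+i≡T _) = walk-no-backtrack (suc i) (trans (cong (w ∘ suc) 2+i≡T) eq)
      by-position (tri> _ _ T<2+i) = walk-moves T (trans eq (cong w (≤-antisym i<T (≤-pred T<2+i))))

    -- If the walk returns to u after T ≥ 2 distinct steps, its vertices are closed under D-neighbours,
    -- hence by connectivity they are all N vertices.
    module ReturnsEarly (T : ℕ) (2≤T : 2 ≤ T) (distinct : DistinctUpTo T) (returns : w (suc T) ≡ w 0) where

      OnWalk : Fin N → Set
      OnWalk y = Σ ℕ λ j → j ≤ T × w j ≡ y

      two-neighbours : ∀ x r l y → r ≢ l → (D ∋ₑ x , r) ≡ true → (D ∋ₑ x , l) ≡ true → (D ∋ₑ x , y) ≡ true → y ≡ r ⊎ y ≡ l
      two-neighbours x r l y r≢l xr xl xy = by-cases (y Fin.≟ r) (y Fin.≟ l)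
        where
        by-cases : Dec (y ≡ r) → Dec (y ≡ l) → y ≡ r ⊎ y ≡ l
        by-cases (yes y≡r) _         = inj₁ y≡r
        by-cases (no _)    (yes y≡l) = inj₂ y≡l
        by-cases (no y≢r)  (no y≢l)  = ⊥-elim (no-three-neighbours x r l y r≢l (y≢r ∘ sym) (y≢l ∘ sym) xr xl xy)

      successor-on-walk : ∀ j → j ≤ T → OnWalk (w (suc j))
      successor-on-walk j j≤T = by-cases (m≤n⇒m<n∨m≡n j≤T)
        where
        by-cases : j < T ⊎ j ≡ T → OnWalk (w (suc j))
        by-cases (inj₁ j<T) = suc j , j<T , refl
        by-cases (inj₂ j≡T) = 0 , z≤n , sym (trans (cong (w ∘ suc) j≡T) returns)

      two-back-differs : ∀ j → suc j ≤ T → w (suc (suc j)) ≢ w j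
      two-back-differs j 1+j≤T = by-cases (m≤n⇒m<n∨m≡n 1+j≤T)
        where
        by-cases : suc j < T ⊎ suc j ≡ T → w (suc (suc j)) ≢ w j
        by-cases (inj₁ 1+j<T) = distinct-≢ distinct 1+j<T (≤-trans (n≤1+n j) 1+j≤T)
                                  (λ 2+j≡j → <-irrefl (sym 2+j≡j) (≤-trans (n<1+n j) (n≤1+n (suc j))))
        by-cases (inj₂ 1+j≡T) eq = distinct-≢ distinct z≤n (≤-trans (n≤1+n j) 1+j≤T)
                                  (λ 0≡j → <-irrefl 0≡j (≤-pred (subst (2 ≤_) (sym 1+j≡T) 2≤T)))
                                  (trans (sym returns) (trans (cong (w ∘ suc) (sym 1+j≡T)) eq))

      neighbours-on-walk : ∀ j → j ≤ T → ∀ y → (D ∋ₑ w j , y) ≡ true → OnWalk y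
      neighbours-on-walk zero j≤T y xy = by-cases (two-neighbours (w 0) (w 1) (w T) y
        (distinct-≢ distinct (≤-trans (s≤s z≤n) 2≤T) ≤-refl (λ 1≡T → <-irrefl 1≡T 2≤T))
        (walk-step 0) (D-sym (w T) (w 0) (subst (λ z → (D ∋ₑ w T , z) ≡ true) returns (walk-step T))) xy)
        where
        by-cases : y ≡ w 1 ⊎ y ≡ w T → OnWalk y
        by-cases (inj₁ y≡w₁) = subst OnWalk (sym y≡w₁) (successor-on-walk 0 j≤T)
        by-cases (inj₂ y≡wT) = T , ≤-refl , sym y≡wT
      neighbours-on-walk (suc j) j≤T y xy = by-cases (two-neighbours (w (suc j)) (w (suc (suc j))) (w j) y
        (two-back-differs j j≤T) (walk-step (suc j)) (D-sym _ _ (walk-step j)) xy)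
        where
        by-cases : y ≡ w (suc (suc j)) ⊎ y ≡ w j → OnWalk y
        by-cases (inj₁ y≡next) = subst OnWalk (sym y≡next) (successor-on-walk (suc j) j≤T)
        by-cases (inj₂ y≡prev) = j , ≤-trans (n≤1+n j) j≤T , sym y≡prev

      reach-on-walk : ∀ k y → reach G D k (w 0) y ≡ true → OnWalk y
      reach-on-walk zero    y w₀≡y    = 0 , z≤n , ==-sound w₀≡y
      reach-on-walk (suc k) y reached = by-cases (∨-true {reach G D k (w 0) y} reached)
        where
        Step : Fin N → Bool
        Step z = reach G D k (w 0) z ∧ (D ∋ₑ z , y)
        through : Σ (Fin N) (λ z → Step z ≡ true) → OnWalk y
        through (z , step) = extend (reach-on-walk k z (∧-conicalˡ (reach G D k (w 0) z) _ step))
          where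
          extend : OnWalk z → OnWalk y
          extend (j , j≤T , wj≡z) =
            neighbours-on-walk j j≤T y (subst (λ q → (D ∋ₑ q , y) ≡ true) (sym wj≡z) (∧-conicalʳ (reach G D k (w 0) z) _ step))
        by-cases : reach G D k (w 0) y ≡ true ⊎ anyB Step V ≡ true → OnWalk y
        by-cases (inj₁ earlier) = reach-on-walk k y earlier
        by-cases (inj₂ step)    = through (anyB-tabulate⁻ Step id step)

      N≤1+T : N ≤ suc T
      N≤1+T = Fin.injective⇒≤ {f = position} position-injective
        where
        on-walk : ∀ y → OnWalk y
        on-walk y = reach-on-walk N y (isHamCycle⇒connected D ham (w 0) y)
        position : Fin N → Fin (suc T)
        position y = fromℕ< (s≤s (proj₁ (proj₂ (on-walk y))))
        position-injective : ∀ {y y′} → position y ≡ position y′ → y ≡ y′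
        position-injective {y} {y′} eq =
          trans (sym (proj₂ (proj₂ (on-walk y))))
            (trans (cong w (trans (sym (Fin.toℕ-fromℕ< _)) (trans (cong toℕ eq) (Fin.toℕ-fromℕ< _))))
                   (proj₂ (proj₂ (on-walk y′))))

    distinct-extend : ∀ T → DistinctUpTo T → (∀ i → i ≤ T → w (suc T) ≢ w i) → DistinctUpTo (suc T)
    distinct-extend T distinct new i j i≤1+T j≤1+T eq = by-cases (m≤n⇒m<n∨m≡n i≤1+T) (m≤n⇒m<n∨m≡n j≤1+T)
      where
      by-cases : i < suc T ⊎ i ≡ suc T → j < suc T ⊎ j ≡ suc T → i ≡ j
      by-cases (inj₁ i<1+T) (inj₁ j<1+T) = distinct i j (≤-pred i<1+T) (≤-pred j<1+T) eq
      by-cases (inj₁ i<1+T) (inj₂ j≡1+T) = ⊥-elim (new i (≤-pred i<1+T) (trans (cong w (sym j≡1+T)) (sym eq)))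
      by-cases (inj₂ i≡1+T) (inj₁ j<1+T) = ⊥-elim (new j (≤-pred j<1+T) (trans (cong w (sym i≡1+T)) eq))
      by-cases (inj₂ i≡1+T) (inj₂ j≡1+T) = trans i≡1+T (sym j≡1+T)

    distinct-step : ∀ T → suc (suc T) < N → DistinctUpTo (suc T) → DistinctUpTo (suc (suc T))
    distinct-step T 2+T<N distinct = distinct-extend (suc T) distinct new
      where
      returns-early : ∀ T′ → T′ ≡ T → w (suc (suc T)) ≢ w 0
      returns-early zero      refl = walk-no-backtrack 0
      returns-early (suc T′) refl eq =
        <-irrefl refl (≤-trans 2+T<N (ReturnsEarly.N≤1+T (suc (suc T′)) (s≤s (s≤s z≤n)) distinct eq))
      new : ∀ i → i ≤ suc T → w (suc (suc T)) ≢ w i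
      new i i≤1+T eq = returns-early T refl (trans eq (cong w (first-repeat-is-start (suc T) distinct i i≤1+T eq)))

    distinct-upto : ∀ T → T < N → DistinctUpTo T
    distinct-upto zero          _     zero zero _ _ _ = refl
    distinct-upto (suc zero)    _     = distinct-extend 0 (distinct-upto 0 (s≤s z≤n)) λ { zero _ → walk-moves 0 }
    distinct-upto (suc (suc T)) 2+T<N = distinct-step T 2+T<N (distinct-upto (suc T) (<-trans (n<1+n (suc T)) 2+T<N))

    distinct-all : DistinctUpTo ℓ
    distinct-all = distinct-upto ℓ ℓ<N

    walk-returns : (D ∋ₑ w ℓ , u) ≡ true
    walk-returns = subst (λ z → (D ∋ₑ w ℓ , z) ≡ true) w[N]≡u (walk-step ℓ)
      where
      hit : Σ (Fin N) λ i → w (toℕ i) ≡ w N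
      hit = injective⇒surjective (w ∘ toℕ)
              (λ i j eq → Fin.toℕ-injective (distinct-all _ _ (≤-pred (Fin.toℕ<n i)) (≤-pred (Fin.toℕ<n j)) eq)) (w N)
      w[N]≡u : w N ≡ u
      w[N]≡u = trans (sym (proj₂ hit))
                     (cong w (first-repeat-is-start ℓ distinct-all _ (≤-pred (Fin.toℕ<n (proj₁ hit))) (sym (proj₂ hit))))

    walkOf-isHamPath : IsHamPath (walkOf D)
    walkOf-isHamPath = record
      { starts-u  = at-walkOf D (s≤s z≤n)
      ; starts-v  = at-walkOf D (s≤s (s≤s z≤n))
      ; injective = λ i j i<N j<N eq →
          distinct-all i j (≤-pred i<N) (≤-pred j<N) (trans (sym (at-walkOf D i<N)) (trans eq (at-walkOf D j<N)))
      ; adjacent  = λ j 1+j<N →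
          subst₂ (λ a b → adjG a b ≡ true) (sym (at-walkOf D (<-trans (n<1+n j) 1+j<N))) (sym (at-walkOf D 1+j<N))
                 (proj₂ (isHamCycle⇒edgesOk D ham _ _ (walk-step j))) }

    walkOf-closing : closingᵇ (walkOf D) ≡ true
    walkOf-closing = cong₂ _∧_ (IsHamPath⇒isHamPathᵇ _ walkOf-isHamPath)
      (subst (λ z → adjG u z ≡ true) (sym (at-walkOf D ℓ<N)) (trans (symG _ _) (proj₂ (isHamCycle⇒edgesOk D ham _ _ walk-returns))))

    walk-step-cyclic : ∀ {i} → i < N → (D ∋ₑ at (walkOf D) i , at (walkOf D) (next i)) ≡ true
    walk-step-cyclic {i} i<N = subst₂ (λ a b → (D ∋ₑ a , b) ≡ true) (sym (at-walkOf D i<N)) (sym (at-walkOf D (next-< i<N))) (step (suc<N⊎≡ℓ i<N))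
      where
      step : suc i < N ⊎ i ≡ ℓ → (D ∋ₑ w i , w (next i)) ≡ true
      step (inj₁ 1+i<N) = subst (λ z → (D ∋ₑ w i , w z) ≡ true) (sym (next-suc 1+i<N)) (walk-step i)
      step (inj₂ refl)  = subst (λ z → (D ∋ₑ w ℓ , w z) ≡ true) (sym next-ℓ) walk-returns

    cycleEdge⇒D : ∀ x y → cycleEdgeᵇ (walkOf D) x y ≡ true → (D ∋ₑ x , y) ≡ true
    cycleEdge⇒D x y edge = by-position (cycleEdgeᵇ-elim (walkOf D) x y edge)
      where
      by-position : (Σ ℕ λ i → i < N × SameEdge x y (at (walkOf D) i) (at (walkOf D) (next i))) → (D ∋ₑ x , y) ≡ true
      by-position (i , i<N , inj₁ (refl , refl)) = walk-step-cyclic i<N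
      by-position (i , i<N , inj₂ (refl , refl)) = D-sym _ _ (walk-step-cyclic i<N)

    -- Both edge sets are 2-regular and one contains the other.
    cycleOf-walkOf : cycleOf (walkOf D) ≡ D
    cycleOf-walkOf = trans (Vec.tabulate-cong (λ x → trans (Vec.tabulate-cong (same-row x)) (Vec.tabulate∘lookup (lookup D x))))
                           (Vec.tabulate∘lookup D)
      where
      same-row : ∀ x y → cycleEdgeᵇ (walkOf D) x y ≡ (D ∋ₑ x , y)
      same-row x = Enumeration.⊆∧count≡⇒≡ Fin._≟_ V-enum (cycleEdgeᵇ (walkOf D) x) (λ y → D ∋ₑ x , y) (cycleEdge⇒D x)
        (trans (CycleOfPath.cycle-degree (walkOf D) walkOf-isHamPath x) (sym (isHamCycle⇒degreesTwo D ham x)))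

  module WalkOfClosingPath (P : Seq) (closing : closingᵇ P ≡ true) where
    open ClosingCycle P closing
    open IsHamPath path
    open CycleOfPath P path

    private
      D : EdgeSet N
      D = cycleOf P

    nextOnCycle-at : ∀ t → suc (suc t) < N → nextOnCycle D (at P t) (at P (suc t)) ≡ at P (suc (suc t))
    nextOnCycle-at t 2+t<N = by-neighbour (cycle-neighbours z (<-trans (n<1+n _) 2+t<N) z-adjacent)
      where
      z : Fin N
      z = nextOnCycle D (at P t) (at P (suc t))
      spec : ((D ∋ₑ at P (suc t) , z) ∧ not (z == at P t)) ≡ true
      spec = WalkOfCycle.nextOnCycle-spec D cycleOf-isHamCycle cycleOf-uv (at P t) (at P (suc t))
      z-adjacent : cycleEdgeᵇ P (at P (suc t)) z ≡ true
      z-adjacent = trans (sym (cycleOf-∋ P (at P (suc t)) z)) (∧-conicalˡ (D ∋ₑ at P (suc t) , z) _ spec)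
      by-neighbour : z ≡ at P (next (suc t)) ⊎ z ≡ at P (prev (suc t)) → z ≡ at P (suc (suc t))
      by-neighbour (inj₁ z≡next) = trans z≡next (cong (at P) (next-suc 2+t<N))
      by-neighbour (inj₂ z≡prev) = ⊥-elim (false≢true (trans (sym (cong not (trans (cong (_== at P t) z≡prev) (==-refl (at P t)))))
                                                  (∧-conicalʳ (D ∋ₑ at P (suc t) , z) _ spec)))

    walkSteps-at : ∀ t → suc t < N → walkSteps D t ≡ (at P t , at P (suc t))
    walkSteps-at zero    _     = cong₂ _,_ (sym starts-u) (sym starts-v)
    walkSteps-at (suc t) 2+t<N =
      trans (cong (λ q → proj₂ q , nextOnCycle D (proj₁ q) (proj₂ q)) (walkSteps-at t (<-trans (n<1+n _) 2+t<N)))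
            (cong (at P (suc t) ,_) (nextOnCycle-at t 2+t<N))

    walkAt-at : ∀ {j} → j < N → walkAt D j ≡ at P j
    walkAt-at {zero}  _     = sym starts-u
    walkAt-at {suc j} 1+j<N = cong proj₂ (walkSteps-at j 1+j<N)

    walkOf-cycleOf : walkOf D ≡ P
    walkOf-cycleOf = trans (Vec.tabulate-cong (λ i → trans (walkAt-at (Fin.toℕ<n i)) (at-toℕ P i))) (Vec.tabulate∘lookup P)

  edgeSets-enum : Enumeration.Enumerates (Vec.≡-dec (Vec.≡-dec Bool._≟_)) edgeSets
  edgeSets-enum = allVec-enumerates _ (allVec-enumerates Bool._≟_ bools N) N
    where
    bools : Enumeration.Enumerates Bool._≟_ (true ∷ false ∷ [])
    bools = record { exactly-once = λ { true → refl ; false → refl } }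

  hamThrough≡closing : hamThrough u v ≡ count closingᵇ (allVec V N)
  hamThrough≡closing = count-equinumerous (Vec.≡-dec (Vec.≡-dec Bool._≟_)) (Vec.≡-dec Fin._≟_)
    edgeSets-enum (allVec-enumerates Fin._≟_ V-enum N) record
    { to      = walkOf
    ; from    = cycleOf
    ; to-Q    = λ D ham∧uv → WalkOfCycle.walkOf-closing D (∧-conicalˡ (isHamCycle G D) _ ham∧uv) (∧-conicalʳ (isHamCycle G D) _ ham∧uv)
    ; from-P  = λ P closing → cong₂ _∧_ (ClosingCycle.cycleOf-isHamCycle P closing) (ClosingCycle.cycleOf-uv P closing)
    ; from∘to = λ D ham∧uv → WalkOfCycle.cycleOf-walkOf D (∧-conicalˡ (isHamCycle G D) _ ham∧uv) (∧-conicalʳ (isHamCycle G D) _ ham∧uv)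
    ; to∘from = WalkOfClosingPath.walkOf-cycleOf }

  hamThrough-even : 2 ∣ hamThrough u v
  hamThrough-even = subst (2 ∣_) (sym hamThrough≡closing) closing-even

cubic⇒3≤n : (G : Graph) → Cubic G → Fin (n G) → 3 ≤ n G
cubic⇒3≤n G cubic u = subst (_≤ n G) (cubic u) (subst (count (adj G u) (allFin (n G)) ≤_) (length-tabulate id) (count≤length (adj G u) (allFin (n G))))

hamThrough-even : (G : Graph) → 3 ≤ n G → Cubic G → ∀ u x → 2 ∣ Hamiltonian.hamThrough G u x
hamThrough-even record { n = suc (suc (suc M)) ; adj = a ; sym = s ; irrefl = i } _ cubic u x =
  HamiltonPaths.hamThrough-even M a s i cubic u x
hamThrough-even record { n = suc (suc zero) } (s≤s (s≤s ()))
hamThrough-even record { n = suc zero }       (s≤s ())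
hamThrough-even record { n = zero }           ()

-- Pairs of edges at a cubic vertex

complements-sum-even : ∀ {h h′ t t′ T : ℕ} → h + t ≡ T → h′ + t′ ≡ T → 2 ∣ t → 2 ∣ t′ → 2 ∣ h + h′
complements-sum-even {h} {h′} {t} {t′} {T} h+t≡T h′+t′≡T 2∣t 2∣t′ =
  ∣m+n∣m⇒∣n (subst (2 ∣_) 2T≡ (divides T (*-comm 2 T))) (∣m∣n⇒∣m+n 2∣t 2∣t′)
  where
  open ≡-Reasoning
  2T≡ : 2 * T ≡ (t + t′) + (h + h′)
  2T≡ = begin
    2 * T                   ≡⟨ cong (T +_) (+-identityʳ T) ⟩
    T + T                   ≡⟨ cong₂ _+_ (sym h+t≡T) (sym h′+t′≡T) ⟩
    (h + t) + (h′ + t′)     ≡⟨ interchange h t h′ t′ ⟩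
    (h + h′) + (t + t′)     ≡⟨ +-comm (h + h′) (t + t′) ⟩
    (t + t′) + (h + h′)     ∎

module _ (G : Graph) (cubic : Cubic G) where
  open Hamiltonian G

  pair-complement : ∀ s (p : Pair2 G s) → Σ (Fin N) λ k →
    hamThrough₂ s (proj₁ p) (proj₁ (proj₂ p)) + hamThrough s k ≡ hamCount
  pair-complement s (a , b , sa , sb , a<b) = third (Enumeration.count≡3⇒third Fin._≟_ V-enum (adj G s) (cubic s) (Fin.<⇒≢ a<b) sa sb)
    where
    third : (Σ (Fin N) λ k → adj G s k ≡ true × a ≢ k × b ≢ k × (∀ x → adj G s x ≡ true → x ≡ a ⊎ x ≡ b ⊎ x ≡ k)) →
      Σ (Fin N) λ k → hamThrough₂ s a b + hamThrough s k ≡ hamCount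
    third (k , _ , a≢k , b≢k , neighbours) = k , hamThrough₂+hamThrough≡hamCount (Fin.<⇒≢ a<b) a≢k b≢k neighbours

  hamThrough₂-sum-even : ∀ s (p q : Pair2 G s) →
    2 ∣ hamThrough₂ s (proj₁ p) (proj₁ (proj₂ p)) + hamThrough₂ s (proj₁ q) (proj₁ (proj₂ q))
  hamThrough₂-sum-even s p q with pair-complement s p | pair-complement s q
  ... | k , p+k≡ | l , q+l≡ = complements-sum-even p+k≡ q+l≡ (even k) (even l)
    where
    even : ∀ x → 2 ∣ hamThrough s x
    even = hamThrough-even G (cubic⇒3≤n G cubic s) cubic s

lemma3p3 : (G : Graph) → Cubic G → (v w : Fin (n G)) → v ≢ w →
    ((p q : Pair2 G v) → p ≢ q → 2 ∣ (degHˡ G v w p + degHˡ G v w q))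
    × ((p q : Pair2 G w) → p ≢ q → 2 ∣ (degHʳ G v w p + degHʳ G v w q))
lemma3p3 G cubic v w _ =
  (λ p q _ → subst (2 ∣_) (sym (cong₂ _+_ (degHˡ≡hamThrough₂ v w p) (degHˡ≡hamThrough₂ v w q))) (hamThrough₂-sum-even G cubic v p q)) ,
  (λ p q _ → subst (2 ∣_) (sym (cong₂ _+_ (degHʳ≡hamThrough₂ v w p) (degHʳ≡hamThrough₂ v w q))) (hamThrough₂-sum-even G cubic w p q))
  where open Hamiltonian G
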